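{- Let $k\geqslant 1$. For $n\geqslant 0$ and $r\geqslant 0$ let $f_n^r(k)$ be the number of permutations $\pi\in\mathfrak S_n$ that avoid the pattern $132$ and contain exactly $r$ occurrences of the pattern $12\dots k$, and let $F(x,y;k)=\sum_{n\geqslant0}\sum_{r\geqslant0}f_n^r(k)x^ny^r$. Then, as formal power series, $$ F(x,y;k)=\cfrac{1}{1-\cfrac{xy^{d_1}}{1-\cfrac{xy^{d_2}}{1-\cfrac{xy^{d_3}}{\ddots}}}}, $$ where $d_i=\binom{i-1}{k-1}$ for $i\geqslant 1$, with the convention that $\binom ab=0$ whenever $a<b$ or $b<0$.
   Context: For permutations $\pi\in\mathfrak S_n$ and $\tau\in\mathfrak S_k$, an occurrence of $\tau$ in $\pi$ is a subsequence of indices $1\leqslant i_1<\dots<i_k\leqslant n$ such that $(\pi_{i_1},\dots,\pi_{i_k})$ is order-isomorphic to $\tau$ (i.e. $\pi_{i_a}<\pi_{i_b}$ iff $\tau_a<\tau_b$). $\pi$ avoids $\tau$ if there is no occurrence of $\tau$ in $\pi$. The empty permutation ($n=0$) is included and counted. The pattern $12\dots k$ is the identity permutation of length $k$. -}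

module Defs where

open import Data.Bool using (Bool; true; false; _∧_; not; _xor_)
open import Data.Nat using (ℕ; zero; suc; _+_; _*_; _∸_; _<ᵇ_; _≡ᵇ_)
open import Data.Nat.Combinatorics using (_C_)
open import Data.List using (List; []; _∷_; [_]; _++_; map; concatMap; applyUpTo; upTo; length; filterᵇ; zip; and)
open import Data.Nat.ListAction using (sum)
open import Data.Product using (_×_; _,_; proj₁; proj₂)

words : ℕ → ℕ → List (List ℕ)
words n zero    = [ [] ]
words n (suc m) = concatMap (λ a → map (a ∷_) (words n m)) (applyUpTo suc n)

notIn : ℕ → List ℕ → Bool
notIn a []       = true
notIn a (b ∷ bs) = not (a ≡ᵇ b) ∧ notIn a bs

distinct : List ℕ → Bool
distinct []       = true
distinct (a ∷ as) = notIn a as ∧ distinct as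

-- 𝔖ₙ, as the list of one-line notations π₁…πₙ (injective words of
-- length n over {1,…,n}); 𝔖₀ = { empty permutation }
perms : ℕ → List (List ℕ)
perms n = filterᵇ distinct (words n n)

-- all subsequences of length k, one per choice of indices i₁<…<i_k
subseqs : ℕ → List ℕ → List (List ℕ)
subseqs zero    _        = [ [] ]
subseqs (suc k) []       = []
subseqs (suc k) (x ∷ xs) = map (x ∷_) (subseqs k xs) ++ subseqs (suc k) xs

allᵇ : {A : Set} → (A → Bool) → List A → Bool
allᵇ p xs = and (map p xs)

orderIso : List ℕ → List ℕ → Bool
orderIso τ σ = (length τ ≡ᵇ length σ) ∧
  allᵇ (λ p → allᵇ (λ q → not ((proj₁ p <ᵇ proj₁ q) xor (proj₂ p <ᵇ proj₂ q))) ps) ps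
  where ps = zip σ τ

occ : List ℕ → List ℕ → ℕ
occ τ π = length (filterᵇ (orderIso τ) (subseqs (length τ) π))

avoids : List ℕ → List ℕ → Bool
avoids τ π = occ τ π ≡ᵇ 0

pat132 : List ℕ
pat132 = 1 ∷ 3 ∷ 2 ∷ []

idPat : ℕ → List ℕ
idPat k = applyUpTo suc k

f : ℕ → ℕ → ℕ → ℕ
f k n r = length (filterᵇ (λ π → avoids pat132 π ∧ (occ (idPat k) π ≡ᵇ r)) (perms n))

-- Formal power series in x, y (coefficient of xⁿ yʳ at (n , r))

Series : Set
Series = ℕ → ℕ → ℕ

sumTo : ℕ → (ℕ → ℕ) → ℕ
sumTo n g = sum (map g (upTo (suc n)))

one : Series
one zero zero = 1
one _    _    = 0

_⊛_ : Series → Series → Series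
(A ⊛ B) n r = sumTo n λ i → sumTo r λ j → A i j * B (n ∸ i) (r ∸ j)

xy^ : ℕ → Series
xy^ d (suc zero) r = if' (r ≡ᵇ d)
  where
  if' : Bool → ℕ
  if' true  = 1
  if' false = 0
xy^ d _ r = 0

pow : Series → ℕ → Series
pow U zero    = one
pow U (suc m) = U ⊛ pow U m

-- 1/(1 - U) = Σ_{m≥0} U^m, for U with no x⁰ term (then U^m only
-- contributes to x-degrees ≥ m, so the sum for xⁿ stops at m = n)
geom : Series → Series
geom U n r = sumTo n λ m → pow U m n r

-- d_i = binom(i-1, k-1)   (stdlib's C is 0 when the lower index exceeds the upper)
d : ℕ → ℕ → ℕ
d k i = (i ∸ 1) C (k ∸ 1)

-- truncated continued fraction of depth m starting at level i:
--   CF k 0 i       = 1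
--   CF k (m+1) i   = 1 / (1 - x y^{d_i} · CF k m (i+1))
-- so CF k m 1 = 1/(1 - x y^{d_1}/(1 - … /(1 - x y^{d_m})))
CF : ℕ → ℕ → ℕ → Series
CF k zero    i = one
CF k (suc m) i = geom (xy^ (d k i) ⊛ CF k m (suc i))

{-# OPTIONS --safe #-}
module Submission where

-- Expanding every level of the truncated continued fraction as a geometric series makes it the
-- generating function of words decomposed into arches; these words are exactly the level
-- sequences (s₁ … sₙ with sₙ = 0 and sᵢ ≤ sᵢ₊₁ + 1) of height below the depth, where a letter j
-- contributes x y^binom(j, k−1).  For depth ≥ n the height bound is void.
--
-- A permutation of length n + 1 is a followed by the renaming σ′ of some σ ∈ 𝔖ₙ.  It avoids 132
-- iff σ does and the letters of σ′ above a increase, that is iff the first letter of σ is at most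
-- a; it then has binom(n + 1 − a, k − 1) more occurrences of 12…k than σ, namely a followed by
-- k − 1 of the n + 1 − a larger letters.  With j = n + 1 − a this is the rule for prepending a
-- letter j to a level sequence, so both sides satisfy the same recursion.

open import Defs
open import Data.Bool using (Bool; true; false; _∧_; not; T; _xor_; if_then_else_)
open import Data.Bool.Properties using (∧-comm)
open import Data.Empty using (⊥-elim)
open import Data.List using (List; []; _∷_; [_]; _++_; map; concatMap; length; filterᵇ; zip; upTo; applyUpTo; _∷ʳ_)
open import Data.List.Properties
  using (map-++; map-∘; length-map; ++-assoc; length-++; filter-++; length-applyUpTo; applyUpTo-∷ʳ; map-upTo; ∷-injectiveˡ; ∷-injectiveʳ)
open import Data.List.Membership.Propositional using (_∈_; find; lose)
open import Data.List.Membership.Propositional.Properties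
  using (∈-filter⁺; ∈-map⁺; ∈-map⁻; ∈-concatMap⁺; ∈-concatMap⁻; ∈-upTo⁺; ∈-upTo⁻; ∈-applyUpTo⁺; ∈-applyUpTo⁻)
open import Data.List.Membership.Propositional.Properties.WithK using (unique∧set⇒bag)
open import Data.List.Relation.Binary.BagAndSetEquality using (∼bag⇒↭)
open import Data.List.Relation.Binary.Disjoint.Propositional using (Disjoint)
open import Data.List.Relation.Binary.Permutation.Propositional using (_↭_)
import Data.List.Relation.Binary.Permutation.Propositional.Properties as Perm
open import Data.List.Relation.Unary.All using (All; []; _∷_)
import Data.List.Relation.Unary.All as All
import Data.List.Relation.Unary.All.Properties as All
open import Data.List.Relation.Unary.Any using (here; there)
open import Data.List.Relation.Unary.Unique.Propositional using (Unique; []; _∷_)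
open import Data.List.Relation.Unary.Unique.Propositional.Properties
  using (++⁺; upTo⁺; applyUpTo⁺₁) renaming (map⁺ to Unique-map⁺; filter⁺ to Unique-filter⁺)
open import Data.Nat using (ℕ; zero; suc; _+_; _*_; _∸_; _≤_; _<_; z≤n; s≤s; _<ᵇ_; _≡ᵇ_; _≤ᵇ_; _≤?_; _<?_)
open import Data.Nat.Combinatorics using (_C_; nCk+nC[k+1]≡[n+1]C[k+1])
open import Data.Nat.ListAction using (sum)
open import Data.Nat.ListAction.Properties using (sum-++; sum-↭)
open import Data.Nat.Properties
open import Algebra.Properties.CommutativeSemigroup +-commutativeSemigroup using () renaming (interchange to +-interchange)
open import Data.Product using (_×_; _,_; proj₁; proj₂; ∃; ∃₂)
open import Data.Sum using (_⊎_; inj₁; inj₂)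
open import Data.Unit using (⊤; tt)
open import Function using (_∘_)
open import Function.Bundles using (_⇔_; mk⇔; Equivalence)
open import Relation.Binary.Definitions using (tri<; tri≈; tri>)
open import Relation.Binary.PropositionalEquality hiding ([_])
open import Relation.Nullary using (Dec; yes; no)
open import Relation.Nullary.Decidable using (T?)
open ≡-Reasoning

private
  variable
    A B : Set

⟦_⟧ : Bool → ℕ
⟦ true ⟧ = 1
⟦ false ⟧ = 0

∑ : List A → (A → ℕ) → ℕ
∑ xs g = sum (map g xs)

∑-++ : (xs ys : List A) (g : A → ℕ) → ∑ (xs ++ ys) g ≡ ∑ xs g + ∑ ys g
∑-++ xs ys g = trans (cong sum (map-++ g xs ys)) (sum-++ (map g xs) (map g ys))

∑-cong : (xs : List A) {g h : A → ℕ} → (∀ x → g x ≡ h x) → ∑ xs g ≡ ∑ xs h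
∑-cong []       e = refl
∑-cong (x ∷ xs) e = cong₂ _+_ (e x) (∑-cong xs e)

∑-congᴬ : {xs : List A} {g h : A → ℕ} → All (λ x → g x ≡ h x) xs → ∑ xs g ≡ ∑ xs h
∑-congᴬ []       = refl
∑-congᴬ (e ∷ es) = cong₂ _+_ e (∑-congᴬ es)

∑-zero : (xs : List A) {g : A → ℕ} → (∀ x → g x ≡ 0) → ∑ xs g ≡ 0
∑-zero []       e = refl
∑-zero (x ∷ xs) e = cong₂ _+_ (e x) (∑-zero xs e)

∑-one : (xs : List A) → ∑ xs (λ _ → 1) ≡ length xs
∑-one []       = refl
∑-one (x ∷ xs) = cong suc (∑-one xs)

∑-+ : (xs : List A) (g h : A → ℕ) → ∑ xs (λ x → g x + h x) ≡ ∑ xs g + ∑ xs h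
∑-+ []       g h = refl
∑-+ (x ∷ xs) g h = trans (cong (g x + h x +_) (∑-+ xs g h)) (+-interchange (g x) (h x) _ _)

*-∑ : (c : ℕ) (xs : List A) (g : A → ℕ) → c * ∑ xs g ≡ ∑ xs (λ x → c * g x)
*-∑ c []       g = *-zeroʳ c
*-∑ c (x ∷ xs) g = trans (*-distribˡ-+ c (g x) (∑ xs g)) (cong (c * g x +_) (*-∑ c xs g))

∑-* : (c : ℕ) (xs : List A) (g : A → ℕ) → ∑ xs g * c ≡ ∑ xs (λ x → g x * c)
∑-* c xs g = trans (*-comm (∑ xs g) c) (trans (*-∑ c xs g) (∑-cong xs (λ x → *-comm c (g x))))

∑-filterᵇ : (p : A → Bool) (xs : List A) (g : A → ℕ) → ∑ (filterᵇ p xs) g ≡ ∑ xs (λ x → ⟦ p x ⟧ * g x)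
∑-filterᵇ p []       g = refl
∑-filterᵇ p (x ∷ xs) g with p x
... | true  = cong₂ _+_ (sym (+-identityʳ (g x))) (∑-filterᵇ p xs g)
... | false = ∑-filterᵇ p xs g

length-filterᵇ : (p : A → Bool) (xs : List A) → length (filterᵇ p xs) ≡ ∑ xs (λ x → ⟦ p x ⟧)
length-filterᵇ p xs = trans (sym (∑-one (filterᵇ p xs)))
  (trans (∑-filterᵇ p xs (λ _ → 1)) (∑-cong xs (λ x → *-identityʳ ⟦ p x ⟧)))

∑-↭ : {xs ys : List A} (g : A → ℕ) → xs ↭ ys → ∑ xs g ≡ ∑ ys g
∑-↭ g p = sum-↭ (Perm.map⁺ g p)

∑-map : (h : A → B) (xs : List A) (g : B → ℕ) → ∑ (map h xs) g ≡ ∑ xs (λ x → g (h x))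
∑-map h []       g = refl
∑-map h (x ∷ xs) g = cong (g (h x) +_) (∑-map h xs g)

∑-concatMap : (F : A → List B) (xs : List A) (g : B → ℕ) → ∑ (concatMap F xs) g ≡ ∑ xs (λ x → ∑ (F x) g)
∑-concatMap F []       g = refl
∑-concatMap F (x ∷ xs) g = trans (∑-++ (F x) (concatMap F xs) g) (cong (∑ (F x) g +_) (∑-concatMap F xs g))

∑-comm : (xs : List A) (ys : List B) (F : A → B → ℕ) →
         ∑ xs (λ x → ∑ ys (F x)) ≡ ∑ ys (λ y → ∑ xs (λ x → F x y))
∑-comm []       ys F = sym (∑-zero ys (λ _ → refl))
∑-comm (x ∷ xs) ys F = trans (cong (∑ ys (F x) +_) (∑-comm xs ys F)) (sym (∑-+ ys (F x) (λ y → ∑ xs (λ x′ → F x′ y))))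

∑-∷ʳ : (xs : List A) (a : A) (g : A → ℕ) → ∑ (xs ∷ʳ a) g ≡ ∑ xs g + g a
∑-∷ʳ xs a g = trans (∑-++ xs [ a ] g) (cong (∑ xs g +_) (+-identityʳ (g a)))

∑-applyUpTo-last : (f : ℕ → ℕ) (n : ℕ) (g : ℕ → ℕ) → ∑ (applyUpTo f (suc n)) g ≡ ∑ (applyUpTo f n) g + g (f n)
∑-applyUpTo-last f n g = trans (cong (λ xs → ∑ xs g) (sym (applyUpTo-∷ʳ f n))) (∑-∷ʳ (applyUpTo f n) (f n) g)

∑-upTo-head : ∀ m (F : ℕ → ℕ) → ∑ (upTo (suc m)) F ≡ F 0 + ∑ (upTo m) (F ∘ suc)
∑-upTo-head m F = cong (F 0 +_) (trans (cong (λ L → ∑ L F) (sym (map-upTo suc m))) (∑-map suc (upTo m) F))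

≡ᵇ-refl : ∀ x → (x ≡ᵇ x) ≡ true
≡ᵇ-refl zero    = refl
≡ᵇ-refl (suc x) = ≡ᵇ-refl x

≢⇒≡ᵇ≡false : ∀ {x y} → x ≢ y → (x ≡ᵇ y) ≡ false
≢⇒≡ᵇ≡false {zero}  {zero}  x≢y = ⊥-elim (x≢y refl)
≢⇒≡ᵇ≡false {zero}  {suc y} _   = refl
≢⇒≡ᵇ≡false {suc x} {zero}  _   = refl
≢⇒≡ᵇ≡false {suc x} {suc y} x≢y = ≢⇒≡ᵇ≡false (x≢y ∘ cong suc)

≡ᵇ-sym : ∀ x y → (x ≡ᵇ y) ≡ (y ≡ᵇ x)
≡ᵇ-sym zero    zero    = refl
≡ᵇ-sym zero    (suc y) = refl
≡ᵇ-sym (suc x) zero    = refl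
≡ᵇ-sym (suc x) (suc y) = ≡ᵇ-sym x y

+-≡ᵇ : ∀ x y r → x ≤ r → (x + y ≡ᵇ r) ≡ (y ≡ᵇ r ∸ x)
+-≡ᵇ zero    y r       _         = refl
+-≡ᵇ (suc x) y (suc r) (s≤s x≤r) = +-≡ᵇ x y r x≤r

+-≡ᵇ-> : ∀ x y r → r < x → (x + y ≡ᵇ r) ≡ false
+-≡ᵇ-> (suc x) y zero    _         = refl
+-≡ᵇ-> (suc x) y (suc r) (s≤s r<x) = +-≡ᵇ-> x y r r<x

+-≡ᵇ-0 : ∀ x y → (x + y ≡ᵇ 0) ≡ (x ≡ᵇ 0) ∧ (y ≡ᵇ 0)
+-≡ᵇ-0 zero    y = refl
+-≡ᵇ-0 (suc x) y = refl

<⇒<ᵇ≡true : ∀ {x y} → x < y → (x <ᵇ y) ≡ true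
<⇒<ᵇ≡true {zero}  {suc y} _         = refl
<⇒<ᵇ≡true {suc x} {suc y} (s≤s x<y) = <⇒<ᵇ≡true x<y

≥⇒<ᵇ≡false : ∀ {x y} → y ≤ x → (x <ᵇ y) ≡ false
≥⇒<ᵇ≡false {x}     {zero}  _         = refl
≥⇒<ᵇ≡false {suc x} {suc y} (s≤s y≤x) = ≥⇒<ᵇ≡false y≤x

<ᵇ≡true⇒< : ∀ x y → (x <ᵇ y) ≡ true → x < y
<ᵇ≡true⇒< x y e = <ᵇ⇒< x y (subst T (sym e) _)

<ᵇ-irrefl : ∀ x → (x <ᵇ x) ≡ false
<ᵇ-irrefl x = ≥⇒<ᵇ≡false (≤-refl {x})

≤⇒≤ᵇ≡true : ∀ {a v} → a ≤ v → (a ≤ᵇ v) ≡ true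
≤⇒≤ᵇ≡true {zero}  _   = refl
≤⇒≤ᵇ≡true {suc a} a≤v = <⇒<ᵇ≡true a≤v

>⇒≤ᵇ≡false : ∀ {a v} → v < a → (a ≤ᵇ v) ≡ false
>⇒≤ᵇ≡false {suc a} (s≤s v≤a) = ≥⇒<ᵇ≡false v≤a

≤ᵇ≡true⇒≤ : ∀ a v → (a ≤ᵇ v) ≡ true → a ≤ v
≤ᵇ≡true⇒≤ a v e = ≤ᵇ⇒≤ a v (subst T (sym e) _)

<ᵇ-suc : ∀ a v → (a <ᵇ suc v) ≡ (a ≤ᵇ v)
<ᵇ-suc zero    v = refl
<ᵇ-suc (suc a) v = refl

≢⇒≤ᵇ≡<ᵇ : ∀ {a v} → a ≢ v → (a ≤ᵇ v) ≡ (a <ᵇ v)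
≢⇒≤ᵇ≡<ᵇ {a} {v} a≢v with a ≤? v
... | yes a≤v = trans (≤⇒≤ᵇ≡true a≤v) (sym (<⇒<ᵇ≡true (≤∧≢⇒< a≤v a≢v)))
... | no  a≰v = trans (>⇒≤ᵇ≡false (≰⇒> a≰v)) (sym (≥⇒<ᵇ≡false (<⇒≤ (≰⇒> a≰v))))

<ᵇ-asym : ∀ x y → (x <ᵇ y) ∧ not (y <ᵇ x) ≡ (x <ᵇ y)
<ᵇ-asym x y with x <ᵇ y in x<y
... | true  rewrite ≥⇒<ᵇ≡false (<⇒≤ (<ᵇ≡true⇒< x y x<y)) = refl
... | false = refl

not-xor-true : ∀ b → not (b xor true) ≡ b
not-xor-true true  = refl
not-xor-true false = refl

not-xor-false : ∀ b → not (b xor false) ≡ not b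
not-xor-false true  = refl
not-xor-false false = refl

∧-interchange : ∀ a b c d → (a ∧ b) ∧ (c ∧ d) ≡ (a ∧ c) ∧ (b ∧ d)
∧-interchange true  b true  d = refl
∧-interchange true  b false d = ∧-comm b false
∧-interchange false b c     d = refl

∧-absorb : ∀ l a b c → a ∧ b ≡ a → l ∧ (a ∧ (b ∧ c)) ≡ a ∧ (l ∧ c)
∧-absorb l     true  true  c e = refl
∧-absorb l     true  false c ()
∧-absorb true  false b     c e = refl
∧-absorb false false b     c e = refl

∧≡true⇒× : ∀ {a b} → a ∧ b ≡ true → a ≡ true × b ≡ true
∧≡true⇒× {true} {true} _ = refl , refl

⟦∧⟧ : ∀ a b → ⟦ a ∧ b ⟧ ≡ ⟦ a ⟧ * ⟦ b ⟧
⟦∧⟧ true  b = sym (+-identityʳ ⟦ b ⟧)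
⟦∧⟧ false b = refl

∑-⟦∧⟧ : (xs : List A) (p q : A → Bool) → ∑ xs (λ x → ⟦ p x ∧ q x ⟧) ≡ ∑ (filterᵇ p xs) (λ x → ⟦ q x ⟧)
∑-⟦∧⟧ xs p q = trans (∑-cong xs (λ x → ⟦∧⟧ (p x) (q x))) (sym (∑-filterᵇ p xs (λ x → ⟦ q x ⟧)))

allᵇ-cong : (xs : List A) {p q : A → Bool} → (∀ x → p x ≡ q x) → allᵇ p xs ≡ allᵇ q xs
allᵇ-cong []       e = refl
allᵇ-cong (x ∷ xs) e = cong₂ _∧_ (e x) (allᵇ-cong xs e)

allᵇ-congᴬ : {xs : List A} {p q : A → Bool} → All (λ x → p x ≡ q x) xs → allᵇ p xs ≡ allᵇ q xs
allᵇ-congᴬ []       = refl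
allᵇ-congᴬ (e ∷ es) = cong₂ _∧_ e (allᵇ-congᴬ es)

allᵇ-∧ : (xs : List A) (p q : A → Bool) → allᵇ (λ x → p x ∧ q x) xs ≡ allᵇ p xs ∧ allᵇ q xs
allᵇ-∧ []       p q = refl
allᵇ-∧ (x ∷ xs) p q = trans (cong ((p x ∧ q x) ∧_) (allᵇ-∧ xs p q)) (∧-interchange (p x) (q x) _ _)

allᵇ-map : (g : A → B) (xs : List A) (p : B → Bool) → allᵇ p (map g xs) ≡ allᵇ (λ x → p (g x)) xs
allᵇ-map g []       p = refl
allᵇ-map g (x ∷ xs) p = cong (p (g x) ∧_) (allᵇ-map g xs p)

allᵇ≡true⇒All : (p : A → Bool) (xs : List A) → allᵇ p xs ≡ true → All (λ x → p x ≡ true) xs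
allᵇ≡true⇒All p []       _ = []
allᵇ≡true⇒All p (x ∷ xs) e = let (px , pxs) = ∧≡true⇒× e in px ∷ allᵇ≡true⇒All p xs pxs

All⇒allᵇ≡true : {p : A → Bool} {xs : List A} → All (λ x → p x ≡ true) xs → allᵇ p xs ≡ true
All⇒allᵇ≡true []         = refl
All⇒allᵇ≡true (px ∷ pxs) rewrite px = All⇒allᵇ≡true pxs

allᵇ-filterᵇ : (p : A → Bool) (L : List A) → allᵇ p (filterᵇ p L) ≡ true
allᵇ-filterᵇ p []      = refl
allᵇ-filterᵇ p (x ∷ L) with p x in px
... | true  rewrite px = allᵇ-filterᵇ p L
... | false = allᵇ-filterᵇ p L

allᵇ-filterᵇ⁺ : (p q : A → Bool) (L : List A) → allᵇ q L ≡ true → allᵇ q (filterᵇ p L) ≡ true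
allᵇ-filterᵇ⁺ p q L e = All⇒allᵇ≡true (All.filter⁺ (T? ∘ p) (allᵇ≡true⇒All q L e))

allᵇ-∈ : (p : A → Bool) {y : A} {L : List A} → y ∈ L → p y ≡ false → allᵇ p L ≡ false
allᵇ-∈ p {L = x ∷ L} (here refl) py rewrite py = refl
allᵇ-∈ p {L = x ∷ L} (there y∈) py rewrite allᵇ-∈ p y∈ py = ∧-comm (p x) false

filterᵇ-filterᵇ : (p q : A → Bool) (L : List A) → (∀ v → p v ≡ true → q v ≡ true) → filterᵇ p L ≡ filterᵇ p (filterᵇ q L)
filterᵇ-filterᵇ p q []      p⇒q = refl
filterᵇ-filterᵇ p q (x ∷ L) p⇒q with p x in px
... | true  rewrite p⇒q x px | px = cong (x ∷_) (filterᵇ-filterᵇ p q L p⇒q)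
... | false with q x
...   | true  rewrite px = filterᵇ-filterᵇ p q L p⇒q
...   | false = filterᵇ-filterᵇ p q L p⇒q

filterᵇ-map : (q : B → Bool) (φ : A → B) (L : List A) → filterᵇ q (map φ L) ≡ map φ (filterᵇ (q ∘ φ) L)
filterᵇ-map q φ []      = refl
filterᵇ-map q φ (x ∷ L) with q (φ x)
... | true  = cong (φ x ∷_) (filterᵇ-map q φ L)
... | false = filterᵇ-map q φ L

filterᵇ-congᴬ : {p q : A → Bool} {L : List A} → All (λ v → p v ≡ q v) L → filterᵇ p L ≡ filterᵇ q L
filterᵇ-congᴬ {L = []} [] = refl
filterᵇ-congᴬ {p = p} {q} {x ∷ L} (e ∷ es) with p x | q x
filterᵇ-congᴬ {L = x ∷ L} (e  ∷ es) | true  | true  = cong (x ∷_) (filterᵇ-congᴬ es)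
filterᵇ-congᴬ             (e  ∷ es) | false | false = filterᵇ-congᴬ es
filterᵇ-congᴬ             (() ∷ es) | true  | false
filterᵇ-congᴬ             (() ∷ es) | false | true

length-filterᵇ≡ᵇ0 : (p : A → Bool) (L : List A) → (length (filterᵇ p L) ≡ᵇ 0) ≡ allᵇ (not ∘ p) L
length-filterᵇ≡ᵇ0 p []      = refl
length-filterᵇ≡ᵇ0 p (x ∷ L) with p x
... | true  = refl
... | false = length-filterᵇ≡ᵇ0 p L

-- The continued fraction as a generating function of words

∑-δ-below : ∀ x (Y : ℕ → ℕ) r → r ≤ x → ∑ (upTo r) (λ q → ⟦ x ≡ᵇ q ⟧ * Y q) ≡ 0
∑-δ-below x Y zero    _     = refl
∑-δ-below x Y (suc r) 1+r≤x = begin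
  ∑ (upTo (suc r)) (λ q → ⟦ x ≡ᵇ q ⟧ * Y q)      ≡⟨ ∑-applyUpTo-last (λ q → q) r _ ⟩
  ∑ (upTo r) (λ q → ⟦ x ≡ᵇ q ⟧ * Y q) + ⟦ x ≡ᵇ r ⟧ * Y r
    ≡⟨ cong₂ _+_ (∑-δ-below x Y r (<⇒≤ 1+r≤x)) (cong (λ b → ⟦ b ⟧ * Y r) (≢⇒≡ᵇ≡false (>⇒≢ 1+r≤x))) ⟩
  0                                                ∎

∑-δ : ∀ x (Y : ℕ → ℕ) r → x ≤ r → ∑ (upTo (suc r)) (λ q → ⟦ x ≡ᵇ q ⟧ * Y q) ≡ Y x
∑-δ x Y r x≤r = trans (∑-applyUpTo-last (λ q → q) r _) (last (m≤n⇒m<n∨m≡n x≤r))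
  where
  last : x < r ⊎ x ≡ r → ∑ (upTo r) (λ q → ⟦ x ≡ᵇ q ⟧ * Y q) + ⟦ x ≡ᵇ r ⟧ * Y r ≡ Y x
  last (inj₁ x<r@(s≤s x≤r-1)) = begin
    ∑ (upTo r) (λ q → ⟦ x ≡ᵇ q ⟧ * Y q) + ⟦ x ≡ᵇ r ⟧ * Y r
      ≡⟨ cong₂ _+_ (∑-δ x Y _ x≤r-1) (cong (λ b → ⟦ b ⟧ * Y r) (≢⇒≡ᵇ≡false (<⇒≢ x<r))) ⟩
    Y x + 0 ≡⟨ +-identityʳ (Y x) ⟩
    Y x     ∎
  last (inj₂ refl) = begin
    ∑ (upTo x) (λ q → ⟦ x ≡ᵇ q ⟧ * Y q) + ⟦ x ≡ᵇ x ⟧ * Y x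
      ≡⟨ cong₂ _+_ (∑-δ-below x Y x ≤-refl) (cong (λ b → ⟦ b ⟧ * Y x) (≡ᵇ-refl x)) ⟩
    Y x + 0 ≡⟨ +-identityʳ (Y x) ⟩
    Y x     ∎

∑∑-convolution : (us vs : List (List ℕ)) (w₁ w₂ : List ℕ → ℕ) (r : ℕ) →
          ∑ us (λ u → ∑ vs (λ v → ⟦ w₁ u + w₂ v ≡ᵇ r ⟧)) ≡
          ∑ (upTo (suc r)) (λ q → ∑ us (λ u → ⟦ w₁ u ≡ᵇ q ⟧) * ∑ vs (λ v → ⟦ w₂ v ≡ᵇ r ∸ q ⟧))
∑∑-convolution us vs w₁ w₂ r = sym (begin
  ∑ (upTo (suc r)) (λ q → ∑ us (λ u → ⟦ w₁ u ≡ᵇ q ⟧) * Y q)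
    ≡⟨ ∑-cong (upTo (suc r)) (λ q → ∑-* (Y q) us (λ u → ⟦ w₁ u ≡ᵇ q ⟧)) ⟩
  ∑ (upTo (suc r)) (λ q → ∑ us (λ u → ⟦ w₁ u ≡ᵇ q ⟧ * Y q))
    ≡⟨ ∑-comm (upTo (suc r)) us (λ q u → ⟦ w₁ u ≡ᵇ q ⟧ * Y q) ⟩
  ∑ us (λ u → ∑ (upTo (suc r)) (λ q → ⟦ w₁ u ≡ᵇ q ⟧ * Y q))
    ≡⟨ ∑-cong us collapse ⟩
  ∑ us (λ u → ∑ vs (λ v → ⟦ w₁ u + w₂ v ≡ᵇ r ⟧)) ∎)
  where
  Y : ℕ → ℕ
  Y q = ∑ vs (λ v → ⟦ w₂ v ≡ᵇ r ∸ q ⟧)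
  collapse : ∀ u → ∑ (upTo (suc r)) (λ q → ⟦ w₁ u ≡ᵇ q ⟧ * Y q) ≡ ∑ vs (λ v → ⟦ w₁ u + w₂ v ≡ᵇ r ⟧)
  collapse u with w₁ u ≤? r
  ... | yes w≤r = trans (∑-δ (w₁ u) Y r w≤r) (∑-cong vs (λ v → cong ⟦_⟧ (sym (+-≡ᵇ (w₁ u) (w₂ v) r w≤r))))
  ... | no  w≰r = trans (∑-δ-below (w₁ u) Y (suc r) (≰⇒> w≰r))
                        (sym (∑-zero vs (λ v → cong ⟦_⟧ (+-≡ᵇ-> (w₁ u) (w₂ v) r (≰⇒> w≰r)))))

-- A graded family of words: E n lists the words of size n.
Enum : Set
Enum = ℕ → List (List ℕ)

gf : (List ℕ → ℕ) → Enum → Series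
gf w E n r = ∑ (E n) (λ s → ⟦ w s ≡ᵇ r ⟧)

oneᴱ : Enum
oneᴱ zero    = [ [] ]
oneᴱ (suc n) = []

atomᴱ : Enum
atomᴱ (suc zero) = [ [ 0 ] ]
atomᴱ _          = []

convᴱ : (List ℕ → List ℕ → List ℕ) → Enum → Enum → Enum
convᴱ c E F n = concatMap (λ p → concatMap (λ u → map (c u) (F (n ∸ p))) (E p)) (upTo (suc n))

powᴱ : Enum → ℕ → Enum
powᴱ E zero    = oneᴱ
powᴱ E (suc l) = convᴱ _++_ E (powᴱ E l)

geomᴱ : Enum → Enum
geomᴱ E n = concatMap (λ l → powᴱ E l n) (upTo (suc n))

raise : List ℕ → List ℕ → List ℕ
raise z a = map suc a ++ z

blockᴱ : Enum → Enum
blockᴱ W = convᴱ raise atomᴱ W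

-- A letter m of a word read at level i stands for the monomial x y^(d k (m + i)).
-- The words of cfᴱ (M + 1) are sequences of blocks, each a word of cfᴱ M
-- raised by one level and closed by a letter 0.
cfᴱ : ℕ → Enum
cfᴱ zero    = oneᴱ
cfᴱ (suc M) = geomᴱ (blockᴱ (cfᴱ M))

weight : ℕ → ℕ → List ℕ → ℕ
weight k i s = ∑ s (λ m → d k (m + i))

_≗₂_ : Series → Series → Set
F ≗₂ G = ∀ n r → F n r ≡ G n r

⊛-cong : {F F′ G G′ : Series} → F ≗₂ F′ → G ≗₂ G′ → (F ⊛ G) ≗₂ (F′ ⊛ G′)
⊛-cong eF eG n r = ∑-cong (upTo (suc n)) (λ i → ∑-cong (upTo (suc r)) (λ j → cong₂ _*_ (eF i j) (eG (n ∸ i) (r ∸ j))))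

pow-cong : {F F′ : Series} → F ≗₂ F′ → ∀ l → pow F l ≗₂ pow F′ l
pow-cong e zero    n r = refl
pow-cong e (suc l)     = ⊛-cong e (pow-cong e l)

geom-cong : {F F′ : Series} → F ≗₂ F′ → geom F ≗₂ geom F′
geom-cong e n r = ∑-cong (upTo (suc n)) (λ l → pow-cong e l n r)

gf-oneᴱ : (w : List ℕ → ℕ) → w [] ≡ 0 → gf w oneᴱ ≗₂ one
gf-oneᴱ w w[]≡0 zero    zero    rewrite w[]≡0 = refl
gf-oneᴱ w w[]≡0 zero    (suc r) rewrite w[]≡0 = refl
gf-oneᴱ w _     (suc n) zero    = refl
gf-oneᴱ w _     (suc n) (suc r) = refl

gf-atomᴱ : ∀ k i → gf (weight k i) atomᴱ ≗₂ xy^ (d k i)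
gf-atomᴱ k i zero          r = refl
gf-atomᴱ k i (suc (suc n)) r = refl
gf-atomᴱ k i (suc zero)    r rewrite +-identityʳ (d k i) | ≡ᵇ-sym (d k i) r with r ≡ᵇ d k i
... | true  = refl
... | false = refl

gf-convᴱ : (c : List ℕ → List ℕ → List ℕ) (E F : Enum) (w w₁ w₂ : List ℕ → ℕ) →
           (∀ u v → w (c u v) ≡ w₁ u + w₂ v) → gf w (convᴱ c E F) ≗₂ (gf w₁ E ⊛ gf w₂ F)
gf-convᴱ c E F w w₁ w₂ w-additive n r = begin
  ∑ (concatMap (λ p → concatMap (λ u → map (c u) (F (n ∸ p))) (E p)) (upTo (suc n))) [w≡r]
    ≡⟨ ∑-concatMap (λ p → concatMap (λ u → map (c u) (F (n ∸ p))) (E p)) (upTo (suc n)) [w≡r] ⟩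
  ∑ (upTo (suc n)) (λ p → ∑ (concatMap (λ u → map (c u) (F (n ∸ p))) (E p)) [w≡r])
    ≡⟨ ∑-cong (upTo (suc n)) (λ p → trans (∑-concatMap (λ u → map (c u) (F (n ∸ p))) (E p) [w≡r])
                                          (∑-cong (E p) (split-weight p))) ⟩
  ∑ (upTo (suc n)) (λ p → ∑ (E p) (λ u → ∑ (F (n ∸ p)) (λ v → ⟦ w₁ u + w₂ v ≡ᵇ r ⟧)))
    ≡⟨ ∑-cong (upTo (suc n)) (λ p → ∑∑-convolution (E p) (F (n ∸ p)) w₁ w₂ r) ⟩
  (gf w₁ E ⊛ gf w₂ F) n r ∎
  where
  [w≡r] : List ℕ → ℕ
  [w≡r] s = ⟦ w s ≡ᵇ r ⟧
  split-weight : ∀ p u → ∑ (map (c u) (F (n ∸ p))) [w≡r] ≡ ∑ (F (n ∸ p)) (λ v → ⟦ w₁ u + w₂ v ≡ᵇ r ⟧)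
  split-weight p u = trans (∑-map (c u) (F (n ∸ p)) [w≡r])
                           (∑-cong (F (n ∸ p)) (λ v → cong (λ z → ⟦ z ≡ᵇ r ⟧) (w-additive u v)))

weight-++ : ∀ k i u v → weight k i (u ++ v) ≡ weight k i u + weight k i v
weight-++ k i u v = ∑-++ u v _

weight-raise : ∀ k i z a → weight k i (raise z a) ≡ weight k i z + weight k (suc i) a
weight-raise k i z a = begin
  weight k i (map suc a ++ z)             ≡⟨ weight-++ k i (map suc a) z ⟩
  weight k i (map suc a) + weight k i z   ≡⟨ +-comm _ (weight k i z) ⟩
  weight k i z + weight k i (map suc a)
    ≡⟨ cong (weight k i z +_) (trans (∑-map suc a _) (∑-cong a (λ m → cong (d k) (sym (+-suc m i))))) ⟩
  weight k i z + weight k (suc i) a       ∎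

module _ (w : List ℕ → ℕ) (w-[] : w [] ≡ 0) (w-++ : ∀ u v → w (u ++ v) ≡ w u + w v) where

  gf-powᴱ : ∀ (E : Enum) l → gf w (powᴱ E l) ≗₂ pow (gf w E) l
  gf-powᴱ E zero    = gf-oneᴱ w w-[]
  gf-powᴱ E (suc l) n r =
    trans (gf-convᴱ _++_ E (powᴱ E l) w w w w-++ n r) (⊛-cong {gf w E} (λ _ _ → refl) (gf-powᴱ E l) n r)

  gf-geomᴱ : ∀ (E : Enum) → gf w (geomᴱ E) ≗₂ geom (gf w E)
  gf-geomᴱ E n r = trans (∑-concatMap (λ l → powᴱ E l n) (upTo (suc n)) _) (∑-cong (upTo (suc n)) (λ l → gf-powᴱ E l n r))

CF≗gf-cfᴱ : ∀ k M i → CF k M i ≗₂ gf (weight k i) (cfᴱ M)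
CF≗gf-cfᴱ k zero    i n r = sym (gf-oneᴱ (weight k i) refl n r)
CF≗gf-cfᴱ k (suc M) i n r = sym (trans (gf-geomᴱ (weight k i) refl (weight-++ k i) _ n r) (geom-cong gf-blocks n r))
  where
  gf-blocks : gf (weight k i) (blockᴱ (cfᴱ M)) ≗₂ (xy^ (d k i) ⊛ CF k M (suc i))
  gf-blocks n r = trans (gf-convᴱ raise atomᴱ (cfᴱ M) (weight k i) (weight k i) (weight k (suc i)) (weight-raise k i) n r)
                        (⊛-cong (gf-atomᴱ k i) (λ n r → sym (CF≗gf-cfᴱ k M (suc i) n r)) n r)

-- Its words are the level sequences

∈-concatMap⁻′ : {f : A → List B} {y : B} (xs : List A) → y ∈ concatMap f xs → ∃ λ x → x ∈ xs × y ∈ f x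
∈-concatMap⁻′ {f = f} xs y∈ = find (∈-concatMap⁻ f {xs} y∈)

∈-concatMap⁺′ : {f : A → List B} {y : B} {x : A} {xs : List A} → x ∈ xs → y ∈ f x → y ∈ concatMap f xs
∈-concatMap⁺′ {f = f} x∈ y∈ = ∈-concatMap⁺ f (lose x∈ y∈)

Unique-map : {f : A → B} (xs : List A) → Unique xs →
             (∀ {x y} → x ∈ xs → y ∈ xs → f x ≡ f y → x ≡ y) → Unique (map f xs)
Unique-map []       _              _   = []
Unique-map (x ∷ xs) (x∉xs ∷ uniq) inj =
  All.tabulate (λ fy∈ fx≡fy → let (y , y∈ , fy≡) = ∈-map⁻ _ fy∈ in
                 All.lookup x∉xs y∈ (inj (here refl) (there y∈) (trans fx≡fy fy≡)))
  ∷ Unique-map xs uniq (λ x∈ y∈ → inj (there x∈) (there y∈))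

Unique-concatMap : {f : A → List B} (xs : List A) → Unique xs → (∀ {x} → x ∈ xs → Unique (f x)) →
                   (∀ {x x′ y} → x ∈ xs → x′ ∈ xs → y ∈ f x → y ∈ f x′ → x ≡ x′) → Unique (concatMap f xs)
Unique-concatMap []       _              _     _   = []
Unique-concatMap {f = f} (x ∷ xs) (x∉xs ∷ uniq) uniq-f tag =
  ++⁺ (uniq-f (here refl)) (Unique-concatMap xs uniq (uniq-f ∘ there) (λ x∈ x′∈ → tag (there x∈) (there x′∈))) disjoint
  where
  disjoint : Disjoint (f x) (concatMap f xs)
  disjoint (y∈fx , y∈rest) with x′ , x′∈ , y∈fx′ ← ∈-concatMap⁻′ xs y∈rest =
    All.lookup x∉xs x′∈ (tag (here refl) (there x′∈) y∈fx y∈fx′)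

data ConvMember (c : List ℕ → List ℕ → List ℕ) (E F : Enum) (n : ℕ) : List ℕ → Set where
  conv : ∀ {p u v} → p ≤ n → u ∈ E p → v ∈ F (n ∸ p) → ConvMember c E F n (c u v)

∈-convᴱ⁻ : ∀ {c E F n s} → s ∈ convᴱ c E F n → ConvMember c E F n s
∈-convᴱ⁻ {c} {E} {F} {n} s∈
  with p , p∈ , s∈p ← ∈-concatMap⁻′ (upTo (suc n)) s∈
  with u , u∈ , s∈u ← ∈-concatMap⁻′ (E p) s∈p
  with v , v∈ , refl ← ∈-map⁻ (c u) s∈u
  = conv (≤-pred (∈-upTo⁻ p∈)) u∈ v∈

∈-convᴱ⁺ : ∀ c E F n {p u v} → p ≤ n → u ∈ E p → v ∈ F (n ∸ p) → c u v ∈ convᴱ c E F n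
∈-convᴱ⁺ c E F n p≤n u∈ v∈ = ∈-concatMap⁺′ (∈-upTo⁺ (s≤s p≤n)) (∈-concatMap⁺′ u∈ (∈-map⁺ _ v∈))

Unique-convᴱ : ∀ c (E F : Enum) n → (∀ p → Unique (E p)) → (∀ q → Unique (F q)) →
               (∀ p {u} → u ∈ E p → length u ≡ p) →
               (∀ p p′ {u u′ v v′} → u ∈ E p → u′ ∈ E p′ → v ∈ F (n ∸ p) → v′ ∈ F (n ∸ p′) →
                  c u v ≡ c u′ v′ → u ≡ u′ × v ≡ v′) →
               Unique (convᴱ c E F n)
Unique-convᴱ c E F n uniq-E uniq-F graded c-injective =
  Unique-concatMap (upTo (suc n)) (upTo⁺ (suc n)) (λ {p} _ → Unique-part p) same-part
  where
  part : ℕ → List (List ℕ)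
  part p = concatMap (λ u → map (c u) (F (n ∸ p))) (E p)

  ∈-part⁻ : ∀ {p y} → y ∈ part p → ∃₂ λ u v → u ∈ E p × v ∈ F (n ∸ p) × y ≡ c u v
  ∈-part⁻ {p} y∈ with u , u∈ , y∈u ← ∈-concatMap⁻′ (E p) y∈ with v , v∈ , y≡ ← ∈-map⁻ (c u) y∈u =
    u , v , u∈ , v∈ , y≡

  Unique-part : ∀ p → Unique (part p)
  Unique-part p = Unique-concatMap (E p) (uniq-E p)
    (λ u∈ → Unique-map (F (n ∸ p)) (uniq-F (n ∸ p)) (λ v∈ v′∈ e → proj₂ (c-injective p p u∈ u∈ v∈ v′∈ e)))
    (λ u∈ u′∈ y∈ y∈′ → let (v , v∈ , y≡) = ∈-map⁻ _ y∈ ; (v′ , v′∈ , y≡′) = ∈-map⁻ _ y∈′ in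
       proj₁ (c-injective p p u∈ u′∈ v∈ v′∈ (trans (sym y≡) y≡′)))

  same-part : ∀ {p p′ y} → p ∈ upTo (suc n) → p′ ∈ upTo (suc n) → y ∈ part p → y ∈ part p′ → p ≡ p′
  same-part {p} {p′} _ _ y∈ y∈′
    with u , v , u∈ , v∈ , y≡ ← ∈-part⁻ y∈
    with u′ , v′ , u′∈ , v′∈ , y≡′ ← ∈-part⁻ y∈′
    = trans (sym (graded p u∈))
            (trans (cong length (proj₁ (c-injective p p′ u∈ u′∈ v∈ v′∈ (trans (sym y≡) y≡′)))) (graded p′ u′∈))

∈-oneᴱ⁻ : ∀ {n s} → s ∈ oneᴱ n → s ≡ [] × n ≡ 0
∈-oneᴱ⁻ {zero} (here refl) = refl , refl

∈-atomᴱ⁻ : ∀ {n s} → s ∈ atomᴱ n → s ≡ [ 0 ] × n ≡ 1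
∈-atomᴱ⁻ {suc zero} (here refl) = refl , refl

Unique-oneᴱ : ∀ n → Unique (oneᴱ n)
Unique-oneᴱ zero    = [] ∷ []
Unique-oneᴱ (suc n) = []

Unique-atomᴱ : ∀ n → Unique (atomᴱ n)
Unique-atomᴱ zero          = []
Unique-atomᴱ (suc zero)    = [] ∷ []
Unique-atomᴱ (suc (suc n)) = []

cap : List ℕ → ℕ
cap []      = 0
cap (j ∷ _) = suc j

-- Read from right to left, a level sequence starts at level 0 and climbs at most one level per step.
IsLevelSeq : List ℕ → Set
IsLevelSeq []      = ⊤
IsLevelSeq (j ∷ s) = j ≤ cap s × IsLevelSeq s

levelSeqs : ℕ → List (List ℕ)
levelSeqs zero    = [ [] ]
levelSeqs (suc n) = concatMap (λ s → map (_∷ s) (upTo (suc (cap s)))) (levelSeqs n)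

BoundedLevelSeq : ℕ → ℕ → List ℕ → Set
BoundedLevelSeq M n s = IsLevelSeq s × length s ≡ n × All (_< M) s

zeros : List ℕ → ℕ
zeros []          = 0
zeros (zero  ∷ s) = suc (zeros s)
zeros (suc _ ∷ s) = zeros s

arch : List ℕ → List ℕ → List ℕ
arch a v = raise (0 ∷ v) a

raise-[0]-++ : ∀ a v → raise [ 0 ] a ++ v ≡ arch a v
raise-[0]-++ a v = ++-assoc (map suc a) [ 0 ] v

cap-arch : ∀ a v → cap (arch a v) ≡ suc (cap a)
cap-arch []      v = refl
cap-arch (x ∷ a) v = refl

zeros-arch : ∀ a v → zeros (arch a v) ≡ suc (zeros v)
zeros-arch []      v = refl
zeros-arch (x ∷ a) v = zeros-arch a v

length-arch : ∀ a v → length (arch a v) ≡ suc (length a + length v)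
length-arch []      v = refl
length-arch (x ∷ a) v = cong suc (length-arch a v)

IsLevelSeq-arch⁺ : ∀ a v → IsLevelSeq a → IsLevelSeq v → IsLevelSeq (arch a v)
IsLevelSeq-arch⁺ []      v _            v-ok = z≤n , v-ok
IsLevelSeq-arch⁺ (x ∷ a) v (x≤ , a-ok) v-ok = subst (suc x ≤_) (sym (cap-arch a v)) (s≤s x≤) , IsLevelSeq-arch⁺ a v a-ok v-ok

IsLevelSeq-arch⁻ : ∀ a v → IsLevelSeq (arch a v) → IsLevelSeq a × IsLevelSeq v
IsLevelSeq-arch⁻ []      v (_ , v-ok)  = tt , v-ok
IsLevelSeq-arch⁻ (x ∷ a) v (x≤ , rest) =
  let (a-ok , v-ok) = IsLevelSeq-arch⁻ a v rest in (≤-pred (subst (suc x ≤_) (cap-arch a v) x≤) , a-ok) , v-ok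

All-arch⁺ : ∀ M a v → All (_< M) a → All (_< suc M) v → All (_< suc M) (arch a v)
All-arch⁺ M []      v []          v< = s≤s z≤n ∷ v<
All-arch⁺ M (x ∷ a) v (x< ∷ a<) v< = s≤s x< ∷ All-arch⁺ M a v a< v<

All-arch⁻ : ∀ M a v → All (_< suc M) (arch a v) → All (_< M) a × All (_< suc M) v
All-arch⁻ M []      v (_ ∷ v<)     = [] , v<
All-arch⁻ M (x ∷ a) v (sx< ∷ rest) = let (a< , v<) = All-arch⁻ M a v rest in ≤-pred sx< ∷ a< , v<

arch-injective : ∀ a a′ v v′ → arch a v ≡ arch a′ v′ → a ≡ a′ × v ≡ v′
arch-injective []      []       v v′ refl = refl , refl
arch-injective (x ∷ a) (x′ ∷ a′) v v′ e with refl ← suc-injective (∷-injectiveˡ e) =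
  let (a≡ , v≡) = arch-injective a a′ v v′ (∷-injectiveʳ e) in cong (x ∷_) a≡ , v≡

-- The first-return decomposition: the first letter 0 closes an arch.
arch-split : ∀ s → IsLevelSeq s → s ≢ [] → ∃₂ λ a v → s ≡ arch a v
arch-split []              _        s≢[] = ⊥-elim (s≢[] refl)
arch-split (zero  ∷ s)     _        _    = [] , s , refl
arch-split (suc x ∷ [])    (() , _) _
arch-split (suc x ∷ y ∷ s) (_ , ok) _ with a , v , e ← arch-split (y ∷ s) ok (λ ()) = x ∷ a , v , cong (suc x ∷_) e

zeros≡0⇒≡[] : ∀ s → IsLevelSeq s → zeros s ≡ 0 → s ≡ []
zeros≡0⇒≡[] []      _  _  = refl
zeros≡0⇒≡[] (x ∷ s) ok z≡0 with a , v , e ← arch-split (x ∷ s) ok (λ ()) =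
  ⊥-elim (0≢1+n (trans (sym z≡0) (trans (cong zeros e) (zeros-arch a v))))

zeros≤length : ∀ s → zeros s ≤ length s
zeros≤length []          = z≤n
zeros≤length (zero  ∷ s) = s≤s (zeros≤length s)
zeros≤length (suc _ ∷ s) = m≤n⇒m≤1+n (zeros≤length s)

arch-bounded : ∀ M n m a v → suc m ≤ n → BoundedLevelSeq M m a → BoundedLevelSeq (suc M) (n ∸ suc m) v →
                  BoundedLevelSeq (suc M) n (arch a v)
arch-bounded M n m a v m<n (a-ok , refl , a<) (v-ok , length-v , v<) =
  IsLevelSeq-arch⁺ a v a-ok v-ok ,
  trans (length-arch a v) (trans (cong (λ x → suc (m + x)) length-v) (m+[n∸m]≡n m<n)) ,
  All-arch⁺ M a v a< v<

data BlockMember (W : Enum) : ℕ → List ℕ → Set where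
  block : ∀ {m a} → a ∈ W m → BlockMember W (suc m) (raise [ 0 ] a)

∈-blockᴱ⁻ : ∀ {W p s} → s ∈ blockᴱ W p → BlockMember W p s
∈-blockᴱ⁻ {W} s∈ with ∈-convᴱ⁻ {raise} {atomᴱ} {W} s∈
... | conv 1≤p z∈ a∈ with refl , refl ← ∈-atomᴱ⁻ z∈ = from 1≤p a∈
  where
  from : ∀ {W p a} → 1 ≤ p → a ∈ W (p ∸ 1) → BlockMember W p (raise [ 0 ] a)
  from {p = suc m} _ a∈ = block a∈

∈-blockᴱ⁺ : ∀ {W m a} → a ∈ W m → raise [ 0 ] a ∈ blockᴱ W (suc m)
∈-blockᴱ⁺ {W} {m} a∈ = ∈-convᴱ⁺ raise atomᴱ W (suc m) (s≤s z≤n) (here refl) a∈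

module _ (M : ℕ) (cfᴱ-M : ∀ {n s} → s ∈ cfᴱ M n ⇔ BoundedLevelSeq M n s) where

  private
    Blocks : Enum
    Blocks = blockᴱ (cfᴱ M)

  ∈-powᴱ-blockᴱ⁻ : ∀ l n {s} → s ∈ powᴱ Blocks l n → BoundedLevelSeq (suc M) n s × zeros s ≡ l
  ∈-powᴱ-blockᴱ⁻ zero    n s∈ with refl , refl ← ∈-oneᴱ⁻ s∈ = (tt , refl , []) , refl
  ∈-powᴱ-blockᴱ⁻ (suc l) n s∈ with ∈-convᴱ⁻ {_++_} {Blocks} {powᴱ Blocks l} s∈
  ... | conv {p} {v = v} p≤n u∈ v∈ with ∈-blockᴱ⁻ {cfᴱ M} {p} u∈
  ... | block {m} {a} a∈ =
    let (v-ok , zeros-v) = ∈-powᴱ-blockᴱ⁻ l (n ∸ p) v∈ in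
    subst (λ t → BoundedLevelSeq (suc M) n t × zeros t ≡ suc l) (sym (raise-[0]-++ a v))
      (arch-bounded M n m a v p≤n (Equivalence.to cfᴱ-M a∈) v-ok , trans (zeros-arch a v) (cong suc zeros-v))

  ∈-powᴱ-blockᴱ⁺ : ∀ l n {s} → BoundedLevelSeq (suc M) n s → zeros s ≡ l → s ∈ powᴱ Blocks l n
  ∈-powᴱ-blockᴱ⁺ zero    _ {s} (s-ok , refl , _) z≡0 with refl ← zeros≡0⇒≡[] s s-ok z≡0 = here refl
  ∈-powᴱ-blockᴱ⁺ (suc l) _ {s} (s-ok , refl , s<) z≡1+l
    with a , v , refl ← arch-split s s-ok (λ { refl → 0≢1+n z≡1+l })
    = subst (_∈ powᴱ Blocks (suc l) (length (arch a v))) (raise-[0]-++ a v)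
        (∈-convᴱ⁺ _++_ Blocks (powᴱ Blocks l) _ p≤n (∈-blockᴱ⁺ {cfᴱ M} a∈) v∈)
    where
    p : ℕ
    p = suc (length a)
    n≡p+v : length (arch a v) ≡ p + length v
    n≡p+v = length-arch a v
    p≤n : p ≤ length (arch a v)
    p≤n = subst (p ≤_) (sym n≡p+v) (m≤m+n p (length v))
    a∈ : a ∈ cfᴱ M (length a)
    a∈ = Equivalence.from cfᴱ-M (proj₁ (IsLevelSeq-arch⁻ a v s-ok) , refl , proj₁ (All-arch⁻ M a v s<))
    v∈ : v ∈ powᴱ Blocks l (length (arch a v) ∸ p)
    v∈ = ∈-powᴱ-blockᴱ⁺ l _
           (proj₂ (IsLevelSeq-arch⁻ a v s-ok) , trans (sym (m+n∸m≡n p (length v))) (cong (_∸ p) (sym n≡p+v)) ,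
            proj₂ (All-arch⁻ M a v s<))
           (suc-injective (trans (sym (zeros-arch a v)) z≡1+l))

cfᴱ-char : ∀ M {n s} → s ∈ cfᴱ M n ⇔ BoundedLevelSeq M n s
cfᴱ-char zero    = mk⇔ to from
  where
  to : ∀ {n s} → s ∈ cfᴱ zero n → BoundedLevelSeq zero n s
  to s∈ with refl , refl ← ∈-oneᴱ⁻ s∈ = tt , refl , []
  from : ∀ {n s} → BoundedLevelSeq zero n s → s ∈ cfᴱ zero n
  from {s = []}    (_ , refl , _)     = here refl
  from {s = _ ∷ _} (_ , _ , () ∷ _)
cfᴱ-char (suc M) {n} {s} = mk⇔ to from
  where
  to : s ∈ cfᴱ (suc M) n → BoundedLevelSeq (suc M) n s
  to s∈ with l , _ , s∈l ← ∈-concatMap⁻′ (upTo (suc n)) s∈ = proj₁ (∈-powᴱ-blockᴱ⁻ M (cfᴱ-char M) l n s∈l)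
  from : BoundedLevelSeq (suc M) n s → s ∈ cfᴱ (suc M) n
  from bounded@(_ , length≡n , _) =
    ∈-concatMap⁺′ (∈-upTo⁺ (s≤s (subst (zeros s ≤_) length≡n (zeros≤length s))))
                  (∈-powᴱ-blockᴱ⁺ M (cfᴱ-char M) (zeros s) n bounded refl)

length-cfᴱ : ∀ M {n s} → s ∈ cfᴱ M n → length s ≡ n
length-cfᴱ M s∈ = proj₁ (proj₂ (Equivalence.to (cfᴱ-char M) s∈))

Unique-cfᴱ : ∀ M n → Unique (cfᴱ M n)
Unique-cfᴱ zero    n = Unique-oneᴱ n
Unique-cfᴱ (suc M) n = Unique-concatMap (upTo (suc n)) (upTo⁺ (suc n)) (λ {l} _ → Unique-powᴱ l n) same-zeros
  where
  Blocks : Enum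
  Blocks = blockᴱ (cfᴱ M)

  length-block : ∀ p {u} → u ∈ Blocks p → length u ≡ p
  length-block p u∈ with ∈-blockᴱ⁻ {cfᴱ M} {p} u∈
  ... | block {a = a} a∈ = trans (length-arch a []) (cong suc (trans (+-identityʳ _) (length-cfᴱ M a∈)))

  Unique-blockᴱ : ∀ p → Unique (Blocks p)
  Unique-blockᴱ p = Unique-convᴱ raise atomᴱ (cfᴱ M) p Unique-atomᴱ (Unique-cfᴱ M) length-atom raise-injective
    where
    length-atom : ∀ q {z} → z ∈ atomᴱ q → length z ≡ q
    length-atom _ z∈ with refl , refl ← ∈-atomᴱ⁻ z∈ = refl
    raise-injective : ∀ q q′ {z z′ a a′} → z ∈ atomᴱ q → z′ ∈ atomᴱ q′ →
                      a ∈ cfᴱ M (p ∸ q) → a′ ∈ cfᴱ M (p ∸ q′) →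
                      raise z a ≡ raise z′ a′ → z ≡ z′ × a ≡ a′
    raise-injective _ _ {a = a} {a′} z∈ z′∈ _ _ e with refl , refl ← ∈-atomᴱ⁻ z∈ | refl , refl ← ∈-atomᴱ⁻ z′∈ =
      refl , proj₁ (arch-injective a a′ [] [] e)

  Unique-powᴱ : ∀ l n → Unique (powᴱ Blocks l n)
  Unique-powᴱ zero    n = Unique-oneᴱ n
  Unique-powᴱ (suc l) n = Unique-convᴱ _++_ Blocks (powᴱ Blocks l) n Unique-blockᴱ (Unique-powᴱ l) length-block ++-injective
    where
    ++-injective : ∀ p p′ {u u′ v v′} → u ∈ Blocks p → u′ ∈ Blocks p′ →
                   v ∈ powᴱ Blocks l (n ∸ p) → v′ ∈ powᴱ Blocks l (n ∸ p′) →
                   u ++ v ≡ u′ ++ v′ → u ≡ u′ × v ≡ v′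
    ++-injective p p′ {v = v} {v′} u∈ u′∈ _ _ e with ∈-blockᴱ⁻ {cfᴱ M} {p} u∈ | ∈-blockᴱ⁻ {cfᴱ M} {p′} u′∈
    ... | block {a = a} _ | block {a = a′} _ =
      let (a≡a′ , v≡v′) = arch-injective a a′ v v′ (trans (sym (raise-[0]-++ a v)) (trans e (raise-[0]-++ a′ v′))) in
      cong (raise [ 0 ]) a≡a′ , v≡v′

  same-zeros : ∀ {l l′ s} → l ∈ upTo (suc n) → l′ ∈ upTo (suc n) →
               s ∈ powᴱ Blocks l n → s ∈ powᴱ Blocks l′ n → l ≡ l′
  same-zeros {l} {l′} _ _ s∈ s∈′ =
    trans (sym (proj₂ (∈-powᴱ-blockᴱ⁻ M (cfᴱ-char M) l n s∈))) (proj₂ (∈-powᴱ-blockᴱ⁻ M (cfᴱ-char M) l′ n s∈′))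

∈-levelSeqs⁻ : ∀ n {s} → s ∈ levelSeqs n → IsLevelSeq s × length s ≡ n
∈-levelSeqs⁻ zero    (here refl) = tt , refl
∈-levelSeqs⁻ (suc n) s∈
  with s′ , s′∈ , s∈′ ← ∈-concatMap⁻′ (levelSeqs n) s∈
  with j , j∈ , refl ← ∈-map⁻ _ s∈′
  = let (s′-ok , length-s′) = ∈-levelSeqs⁻ n s′∈ in (≤-pred (∈-upTo⁻ j∈) , s′-ok) , cong suc length-s′

∈-levelSeqs⁺ : ∀ s → IsLevelSeq s → s ∈ levelSeqs (length s)
∈-levelSeqs⁺ []      _           = here refl
∈-levelSeqs⁺ (j ∷ s) (j≤ , s-ok) = ∈-concatMap⁺′ (∈-levelSeqs⁺ s s-ok) (∈-map⁺ (_∷ s) (∈-upTo⁺ (s≤s j≤)))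

Unique-levelSeqs : ∀ n → Unique (levelSeqs n)
Unique-levelSeqs zero    = [] ∷ []
Unique-levelSeqs (suc n) = Unique-concatMap (levelSeqs n) (Unique-levelSeqs n)
  (λ {s} _ → Unique-map (upTo (suc (cap s))) (upTo⁺ (suc (cap s))) (λ _ _ → ∷-injectiveˡ))
  (λ _ _ s∈ s∈′ → let (_ , _ , e) = ∈-map⁻ _ s∈ ; (_ , _ , e′) = ∈-map⁻ _ s∈′ in ∷-injectiveʳ (trans (sym e) e′))

cap≤length : ∀ s → IsLevelSeq s → cap s ≤ length s
cap≤length []      _           = z≤n
cap≤length (j ∷ s) (j≤ , s-ok) = s≤s (≤-trans j≤ (cap≤length s s-ok))

All-<-length : ∀ s → IsLevelSeq s → All (_< length s) s
All-<-length []      _           = []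
All-<-length (j ∷ s) (j≤ , s-ok) = s≤s (≤-trans j≤ (cap≤length s s-ok)) ∷ All.map m≤n⇒m≤1+n (All-<-length s s-ok)

cfᴱ↭levelSeqs : ∀ M n → n ≤ M → cfᴱ M n ↭ levelSeqs n
cfᴱ↭levelSeqs M n n≤M = ∼bag⇒↭ (unique∧set⇒bag (Unique-cfᴱ M n) (Unique-levelSeqs n) (mk⇔ to from))
  where
  to : ∀ {s} → s ∈ cfᴱ M n → s ∈ levelSeqs n
  to s∈ with s-ok , refl , _ ← Equivalence.to (cfᴱ-char M) s∈ = ∈-levelSeqs⁺ _ s-ok
  from : ∀ {s} → s ∈ levelSeqs n → s ∈ cfᴱ M n
  from {s} s∈ with s-ok , refl ← ∈-levelSeqs⁻ n s∈ =
    Equivalence.from (cfᴱ-char M) (s-ok , refl , All.map (λ s<n → ≤-trans s<n n≤M) (All-<-length s s-ok))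

-- Pattern occurrences by the first letter

-- The test orderIso applies to two pairs (letter of the word, letter of the pattern).
agree : ℕ × ℕ → ℕ × ℕ → Bool
agree p q = not ((proj₁ p <ᵇ proj₁ q) xor (proj₂ p <ᵇ proj₂ q))

agreeAll : List (ℕ × ℕ) → Bool
agreeAll ps = allᵇ (λ p → allᵇ (agree p) ps) ps

agree-refl : ∀ p → agree p p ≡ true
agree-refl (x , t) rewrite <ᵇ-irrefl x | <ᵇ-irrefl t = refl

orderIso-∷ : ∀ t τ x s → orderIso (t ∷ τ) (x ∷ s) ≡
             (length τ ≡ᵇ length s) ∧
             (allᵇ (agree (x , t)) (zip s τ) ∧ (allᵇ (λ q → agree q (x , t)) (zip s τ) ∧ agreeAll (zip s τ)))
orderIso-∷ t τ x s = cong ((length τ ≡ᵇ length s) ∧_) (begin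
  (agree p p ∧ allᵇ (agree p) ps) ∧ allᵇ (λ q → agree q p ∧ allᵇ (agree q) ps) ps
    ≡⟨ cong₂ (λ b c → (b ∧ allᵇ (agree p) ps) ∧ c) (agree-refl p)
             (allᵇ-∧ ps (λ q → agree q p) (λ q → allᵇ (agree q) ps)) ⟩
  allᵇ (agree p) ps ∧ (allᵇ (λ q → agree q p) ps ∧ agreeAll ps) ∎)
  where
  p : ℕ × ℕ
  p = (x , t)
  ps : List (ℕ × ℕ)
  ps = zip s τ

allᵇ-agree-zipˡ : ∀ x t s τ β → All (λ t′ → (t <ᵇ t′) ≡ β) τ → length s ≡ length τ →
                  allᵇ (agree (x , t)) (zip s τ) ≡ allᵇ (λ y → not ((x <ᵇ y) xor β)) s
allᵇ-agree-zipˡ x t []      []       β []       _ = refl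
allᵇ-agree-zipˡ x t (y ∷ s) (t′ ∷ τ) β (e ∷ es) l = cong₂ (λ b c → not ((x <ᵇ y) xor b) ∧ c) e
  (allᵇ-agree-zipˡ x t s τ β es (suc-injective l))

allᵇ-agree-zipʳ : ∀ x t s τ β → All (λ t′ → (t′ <ᵇ t) ≡ β) τ → length s ≡ length τ →
                  allᵇ (λ q → agree q (x , t)) (zip s τ) ≡ allᵇ (λ y → not ((y <ᵇ x) xor β)) s
allᵇ-agree-zipʳ x t []      []       β []       _ = refl
allᵇ-agree-zipʳ x t (y ∷ s) (t′ ∷ τ) β (e ∷ es) l = cong₂ (λ b c → not ((y <ᵇ x) xor b) ∧ c) e
  (allᵇ-agree-zipʳ x t s τ β es (suc-injective l))

orderIso-∷-above : ∀ t τ x s → All (t <_) τ → length s ≡ length τ →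
                   orderIso (t ∷ τ) (x ∷ s) ≡ allᵇ (x <ᵇ_) s ∧ orderIso τ s
orderIso-∷-above t τ x s τ>t l = begin
  orderIso (t ∷ τ) (x ∷ s)
    ≡⟨ orderIso-∷ t τ x s ⟩
  (length τ ≡ᵇ length s) ∧ (allᵇ (agree (x , t)) (zip s τ) ∧ (allᵇ (λ q → agree q (x , t)) (zip s τ) ∧ agreeAll (zip s τ)))
    ≡⟨ cong₂ (λ a b → (length τ ≡ᵇ length s) ∧ (a ∧ (b ∧ agreeAll (zip s τ)))) above below ⟩
  (length τ ≡ᵇ length s) ∧ (allᵇ (x <ᵇ_) s ∧ (allᵇ (λ y → not (y <ᵇ x)) s ∧ agreeAll (zip s τ)))
    ≡⟨ ∧-absorb (length τ ≡ᵇ length s) (allᵇ (x <ᵇ_) s) (allᵇ (λ y → not (y <ᵇ x)) s) (agreeAll (zip s τ))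
                (trans (sym (allᵇ-∧ s (x <ᵇ_) (λ y → not (y <ᵇ x)))) (allᵇ-cong s (<ᵇ-asym x))) ⟩
  allᵇ (x <ᵇ_) s ∧ orderIso τ s ∎
  where
  above : allᵇ (agree (x , t)) (zip s τ) ≡ allᵇ (x <ᵇ_) s
  above = trans (allᵇ-agree-zipˡ x t s τ true (All.map <⇒<ᵇ≡true τ>t) l) (allᵇ-cong s (λ y → not-xor-true (x <ᵇ y)))
  below : allᵇ (λ q → agree q (x , t)) (zip s τ) ≡ allᵇ (λ y → not (y <ᵇ x)) s
  below = trans (allᵇ-agree-zipʳ x t s τ false (All.map (≥⇒<ᵇ≡false ∘ <⇒≤) τ>t) l)
                (allᵇ-cong s (λ y → not-xor-false (y <ᵇ x)))

orderIso-∷-below : ∀ t τ x s → All (_< t) τ → length s ≡ length τ →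
                   orderIso (t ∷ τ) (x ∷ s) ≡ allᵇ (_<ᵇ x) s ∧ orderIso τ s
orderIso-∷-below t τ x s τ<t l = begin
  orderIso (t ∷ τ) (x ∷ s)
    ≡⟨ orderIso-∷ t τ x s ⟩
  (length τ ≡ᵇ length s) ∧ (allᵇ (agree (x , t)) (zip s τ) ∧ (allᵇ (λ q → agree q (x , t)) (zip s τ) ∧ agreeAll (zip s τ)))
    ≡⟨ cong₂ (λ a b → (length τ ≡ᵇ length s) ∧ (a ∧ (b ∧ agreeAll (zip s τ)))) above below ⟩
  (length τ ≡ᵇ length s) ∧ (allᵇ (λ y → not (x <ᵇ y)) s ∧ (allᵇ (_<ᵇ x) s ∧ agreeAll (zip s τ)))
    ≡⟨ cong ((length τ ≡ᵇ length s) ∧_) (∧-swap (allᵇ (λ y → not (x <ᵇ y)) s) (allᵇ (_<ᵇ x) s) (agreeAll (zip s τ))) ⟩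
  (length τ ≡ᵇ length s) ∧ (allᵇ (_<ᵇ x) s ∧ (allᵇ (λ y → not (x <ᵇ y)) s ∧ agreeAll (zip s τ)))
    ≡⟨ ∧-absorb (length τ ≡ᵇ length s) (allᵇ (_<ᵇ x) s) (allᵇ (λ y → not (x <ᵇ y)) s) (agreeAll (zip s τ))
                (trans (sym (allᵇ-∧ s (_<ᵇ x) (λ y → not (x <ᵇ y)))) (allᵇ-cong s (λ y → <ᵇ-asym y x))) ⟩
  allᵇ (_<ᵇ x) s ∧ orderIso τ s ∎
  where
  above : allᵇ (agree (x , t)) (zip s τ) ≡ allᵇ (λ y → not (x <ᵇ y)) s
  above = trans (allᵇ-agree-zipˡ x t s τ false (All.map (≥⇒<ᵇ≡false ∘ <⇒≤) τ<t) l)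
                (allᵇ-cong s (λ y → not-xor-false (x <ᵇ y)))
  below : allᵇ (λ q → agree q (x , t)) (zip s τ) ≡ allᵇ (_<ᵇ x) s
  below = trans (allᵇ-agree-zipʳ x t s τ true (All.map <⇒<ᵇ≡true τ<t) l) (allᵇ-cong s (λ y → not-xor-true (y <ᵇ x)))
  ∧-swap : ∀ a b c → a ∧ (b ∧ c) ≡ b ∧ (a ∧ c)
  ∧-swap true  b c = refl
  ∧-swap false true  c = refl
  ∧-swap false false c = refl

subseqs-length : ∀ k (xs : List ℕ) → All (λ s → length s ≡ k) (subseqs k xs)
subseqs-length zero    xs       = refl ∷ []
subseqs-length (suc k) []       = []
subseqs-length (suc k) (x ∷ xs) =
  All.++⁺ (All.map⁺ (All.map (cong suc) (subseqs-length k xs))) (subseqs-length (suc k) xs)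

filterᵇ-allᵇ-subseqs : (p : ℕ → Bool) → ∀ k ys → filterᵇ (allᵇ p) (subseqs k ys) ≡ subseqs k (filterᵇ p ys)
filterᵇ-allᵇ-subseqs p zero    ys       = refl
filterᵇ-allᵇ-subseqs p (suc k) []       = refl
filterᵇ-allᵇ-subseqs p (suc k) (y ∷ ys) with p y in py
... | true  = trans (filter-++ _ (map (y ∷_) (subseqs k ys)) (subseqs (suc k) ys))
                    (cong₂ _++_ (trans (kept (subseqs k ys)) (cong (map (y ∷_)) (filterᵇ-allᵇ-subseqs p k ys)))
                                (filterᵇ-allᵇ-subseqs p (suc k) ys))
  where
  kept : ∀ L → filterᵇ (allᵇ p) (map (y ∷_) L) ≡ map (y ∷_) (filterᵇ (allᵇ p) L)
  kept []      = refl
  kept (s ∷ L) with allᵇ p s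
  ... | true  rewrite py = cong ((y ∷ s) ∷_) (kept L)
  ... | false rewrite py = kept L
... | false = trans (filter-++ _ (map (y ∷_) (subseqs k ys)) (subseqs (suc k) ys))
                    (trans (cong (_++ filterᵇ (allᵇ p) (subseqs (suc k) ys)) (dropped (subseqs k ys)))
                           (filterᵇ-allᵇ-subseqs p (suc k) ys))
  where
  dropped : ∀ L → filterᵇ (allᵇ p) (map (y ∷_) L) ≡ []
  dropped []      = refl
  dropped (s ∷ L) rewrite py = dropped L

occ-as-∑ : ∀ τ π → occ τ π ≡ ∑ (subseqs (length τ) π) (λ s → ⟦ orderIso τ s ⟧)
occ-as-∑ τ π = length-filterᵇ (orderIso τ) (subseqs (length τ) π)

-- An occurrence of t ∷ τ in a ∷ ys either avoids a, or uses a followed by an occurrence of τ in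
-- the letters of ys that compare with a as the letters of τ compare with t.
occ-∷ : ∀ t τ a ys (P : ℕ → Bool) →
        (∀ s → length s ≡ length τ → orderIso (t ∷ τ) (a ∷ s) ≡ allᵇ P s ∧ orderIso τ s) →
        occ (t ∷ τ) (a ∷ ys) ≡ occ τ (filterᵇ P ys) + occ (t ∷ τ) ys
occ-∷ t τ a ys P orderIso-a∷ = begin
  occ (t ∷ τ) (a ∷ ys)
    ≡⟨ occ-as-∑ (t ∷ τ) (a ∷ ys) ⟩
  ∑ (map (a ∷_) (subseqs k ys) ++ subseqs (suc k) ys) [iso]
    ≡⟨ ∑-++ (map (a ∷_) (subseqs k ys)) (subseqs (suc k) ys) [iso] ⟩
  ∑ (map (a ∷_) (subseqs k ys)) [iso] + ∑ (subseqs (suc k) ys) [iso]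
    ≡⟨ cong₂ _+_ using-a (sym (occ-as-∑ (t ∷ τ) ys)) ⟩
  occ τ (filterᵇ P ys) + occ (t ∷ τ) ys ∎
  where
  k : ℕ
  k = length τ
  [iso] : List ℕ → ℕ
  [iso] s = ⟦ orderIso (t ∷ τ) s ⟧
  using-a : ∑ (map (a ∷_) (subseqs k ys)) [iso] ≡ occ τ (filterᵇ P ys)
  using-a = begin
    ∑ (map (a ∷_) (subseqs k ys)) [iso]
      ≡⟨ ∑-map (a ∷_) (subseqs k ys) [iso] ⟩
    ∑ (subseqs k ys) (λ s → ⟦ orderIso (t ∷ τ) (a ∷ s) ⟧)
      ≡⟨ ∑-congᴬ (All.map (λ {s} l → cong ⟦_⟧ (orderIso-a∷ s l)) (subseqs-length k ys)) ⟩
    ∑ (subseqs k ys) (λ s → ⟦ allᵇ P s ∧ orderIso τ s ⟧)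
      ≡⟨ ∑-⟦∧⟧ (subseqs k ys) (allᵇ P) (orderIso τ) ⟩
    ∑ (filterᵇ (allᵇ P) (subseqs k ys)) (λ s → ⟦ orderIso τ s ⟧)
      ≡⟨ cong (λ L → ∑ L (λ s → ⟦ orderIso τ s ⟧)) (filterᵇ-allᵇ-subseqs P k ys) ⟩
    ∑ (subseqs k (filterᵇ P ys)) (λ s → ⟦ orderIso τ s ⟧)
      ≡⟨ sym (occ-as-∑ τ (filterᵇ P ys)) ⟩
    occ τ (filterᵇ P ys) ∎

occ-∷-above : ∀ t τ a ys → All (t <_) τ → occ (t ∷ τ) (a ∷ ys) ≡ occ τ (filterᵇ (a <ᵇ_) ys) + occ (t ∷ τ) ys
occ-∷-above t τ a ys τ>t = occ-∷ t τ a ys (a <ᵇ_) (λ s → orderIso-∷-above t τ a s τ>t)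

occ-∷-below : ∀ t τ a ys → All (_< t) τ → occ (t ∷ τ) (a ∷ ys) ≡ occ τ (filterᵇ (_<ᵇ a) ys) + occ (t ∷ τ) ys
occ-∷-below t τ a ys τ<t = occ-∷ t τ a ys (_<ᵇ a) (λ s → orderIso-∷-below t τ a s τ<t)

increasingᵇ : List ℕ → Bool
increasingᵇ []      = true
increasingᵇ (x ∷ s) = allᵇ (x <ᵇ_) s ∧ increasingᵇ s

increasingSubseqs : ℕ → List ℕ → ℕ
increasingSubseqs k π = ∑ (subseqs k π) (λ s → ⟦ increasingᵇ s ⟧)

orderIso-increasing : ∀ (f : ℕ → ℕ) → (∀ {i j} → i < j → f i < f j) → ∀ k s → length s ≡ k →
                      orderIso (applyUpTo f k) s ≡ increasingᵇ s
orderIso-increasing f f-mono zero    []      _ = refl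
orderIso-increasing f f-mono (suc k) (x ∷ s) l =
  trans (orderIso-∷-above (f 0) (applyUpTo (f ∘ suc) k) x s (All.applyUpTo⁺₁ (f ∘ suc) k (λ _ → f-mono (s≤s z≤n)))
                          (trans (suc-injective l) (sym (length-applyUpTo (f ∘ suc) k))))
        (cong (allᵇ (x <ᵇ_) s ∧_) (orderIso-increasing (f ∘ suc) (f-mono ∘ s≤s) k s (suc-injective l)))

occ-increasing : ∀ (f : ℕ → ℕ) → (∀ {i j} → i < j → f i < f j) → ∀ k π → occ (applyUpTo f k) π ≡ increasingSubseqs k π
occ-increasing f f-mono k π = trans (occ-as-∑ (applyUpTo f k) π)
  (trans (cong (λ m → ∑ (subseqs m π) (λ s → ⟦ orderIso (applyUpTo f k) s ⟧)) (length-applyUpTo f k))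
         (∑-congᴬ (All.map (λ {s} l → cong ⟦_⟧ (orderIso-increasing f f-mono k s l)) (subseqs-length k π))))

occ-idPat-∷ : ∀ k a ys → occ (idPat (suc k)) (a ∷ ys) ≡ increasingSubseqs k (filterᵇ (a <ᵇ_) ys) + occ (idPat (suc k)) ys
occ-idPat-∷ k a ys =
  trans (occ-∷-above 1 (applyUpTo (suc ∘ suc) k) a ys (All.applyUpTo⁺₂ (suc ∘ suc) k (λ _ → s≤s (s≤s z≤n))))
        (cong (_+ occ (idPat (suc k)) ys) (occ-increasing (suc ∘ suc) (s≤s ∘ s≤s) k (filterᵇ (a <ᵇ_) ys)))

inversions : List ℕ → ℕ
inversions = occ (3 ∷ 2 ∷ [])

occ-singleton : ∀ t L → occ [ t ] L ≡ length L
occ-singleton t []      = refl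
occ-singleton t (x ∷ L) rewrite agree-refl (x , t) = cong suc (occ-singleton t L)

occ132-∷ : ∀ a ys → occ pat132 (a ∷ ys) ≡ inversions (filterᵇ (a <ᵇ_) ys) + occ pat132 ys
occ132-∷ a ys = occ-∷-above 1 (3 ∷ 2 ∷ []) a ys (s≤s (s≤s z≤n) ∷ s≤s (s≤s z≤n) ∷ [])

inversions-∷ : ∀ b L → inversions (b ∷ L) ≡ length (filterᵇ (_<ᵇ b) L) + inversions L
inversions-∷ b L = trans (occ-∷-below 3 [ 2 ] b L (s≤s (s≤s (s≤s z≤n)) ∷ []))
                         (cong (_+ inversions L) (occ-singleton 2 (filterᵇ (_<ᵇ b) L)))

increasing-filterᵇ : (p : ℕ → Bool) (L : List ℕ) → increasingᵇ L ≡ true → increasingᵇ (filterᵇ p L) ≡ true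
increasing-filterᵇ p []      _ = refl
increasing-filterᵇ p (x ∷ L) e with ∧≡true⇒× {allᵇ (x <ᵇ_) L} e
... | x<L , L↑ with p x
...   | true  rewrite allᵇ-filterᵇ⁺ p (x <ᵇ_) L x<L = increasing-filterᵇ p L L↑
...   | false = increasing-filterᵇ p L L↑

subseqs-All : {P : ℕ → Set} → ∀ k L → All P L → All (All P) (subseqs k L)
subseqs-All zero    L       _          = [] ∷ []
subseqs-All (suc k) []      _          = []
subseqs-All (suc k) (x ∷ L) (px ∷ pL) =
  All.++⁺ (All.map⁺ (All.map (px ∷_) (subseqs-All k L pL))) (subseqs-All (suc k) L pL)

subseqs-increasing : ∀ k L → increasingᵇ L ≡ true → All (λ s → increasingᵇ s ≡ true) (subseqs k L)
subseqs-increasing zero    L       _ = refl ∷ []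
subseqs-increasing (suc k) []      _ = []
subseqs-increasing (suc k) (x ∷ L) e with ∧≡true⇒× {allᵇ (x <ᵇ_) L} e
... | x<L , L↑ = All.++⁺ (All.map⁺ (All.zipWith (λ (x<s , s↑) → cong₂ _∧_ (All⇒allᵇ≡true x<s) s↑)
                                                (subseqs-All k L (allᵇ≡true⇒All (x <ᵇ_) L x<L) , subseqs-increasing k L L↑)))
                         (subseqs-increasing (suc k) L L↑)

length-subseqs : ∀ k (L : List ℕ) → length (subseqs k L) ≡ length L C k
length-subseqs zero    L       = refl
length-subseqs (suc k) []      = refl
length-subseqs (suc k) (x ∷ L) = begin
  length (map (x ∷_) (subseqs k L) ++ subseqs (suc k) L)
    ≡⟨ length-++ (map (x ∷_) (subseqs k L)) ⟩
  length (map (x ∷_) (subseqs k L)) + length (subseqs (suc k) L)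
    ≡⟨ cong₂ _+_ (trans (length-map (x ∷_) (subseqs k L)) (length-subseqs k L)) (length-subseqs (suc k) L) ⟩
  length L C k + length L C suc k
    ≡⟨ nCk+nC[k+1]≡[n+1]C[k+1] (length L) k ⟩
  suc (length L) C suc k ∎

increasingSubseqs-increasing : ∀ k L → increasingᵇ L ≡ true → increasingSubseqs k L ≡ length L C k
increasingSubseqs-increasing k L L↑ =
  trans (∑-congᴬ (All.map (cong ⟦_⟧) (subseqs-increasing k L L↑))) (trans (∑-one (subseqs k L)) (length-subseqs k L))

inversions≡ᵇ0 : ∀ L → Unique L → (inversions L ≡ᵇ 0) ≡ increasingᵇ L
inversions≡ᵇ0 []      _              = refl
inversions≡ᵇ0 (b ∷ L) (b∉L ∷ uniq) = begin
  (inversions (b ∷ L) ≡ᵇ 0)                                ≡⟨ cong (_≡ᵇ 0) (inversions-∷ b L) ⟩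
  (length (filterᵇ (_<ᵇ b) L) + inversions L ≡ᵇ 0)         ≡⟨ +-≡ᵇ-0 (length (filterᵇ (_<ᵇ b) L)) (inversions L) ⟩
  (length (filterᵇ (_<ᵇ b) L) ≡ᵇ 0) ∧ (inversions L ≡ᵇ 0)
    ≡⟨ cong₂ _∧_ (trans (length-filterᵇ≡ᵇ0 (_<ᵇ b) L) (allᵇ-congᴬ (All.map not-below b∉L))) (inversions≡ᵇ0 L uniq) ⟩
  allᵇ (b <ᵇ_) L ∧ increasingᵇ L ∎
  where
  not-below : ∀ {y} → b ≢ y → not (y <ᵇ b) ≡ (b <ᵇ y)
  not-below {y} b≢y with y <? b
  ... | yes y<b rewrite <⇒<ᵇ≡true y<b | ≥⇒<ᵇ≡false (<⇒≤ y<b) = refl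
  ... | no  y≮b rewrite ≥⇒<ᵇ≡false (≮⇒≥ y≮b) | <⇒<ᵇ≡true (≤∧≢⇒< (≮⇒≥ y≮b) b≢y) = refl

-- lift a renames the letters of a word on {1..n} so that a can be prepended to it.
lift : ℕ → ℕ → ℕ
lift a c = if c <ᵇ a then c else suc c

lift-< : ∀ {a c} → c < a → lift a c ≡ c
lift-< c<a rewrite <⇒<ᵇ≡true c<a = refl

lift-≥ : ∀ {a c} → a ≤ c → lift a c ≡ suc c
lift-≥ a≤c rewrite ≥⇒<ᵇ≡false a≤c = refl

lift-strictMono : ∀ a {x y} → x < y → lift a x < lift a y
lift-strictMono a {x} {y} x<y with x <? a | y <? a
... | yes x<a | yes y<a rewrite lift-< x<a | lift-< y<a = x<y
... | yes x<a | no  y≮a rewrite lift-< x<a | lift-≥ (≮⇒≥ y≮a) = m<n⇒m<1+n x<y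
... | no  x≮a | yes y<a = ⊥-elim (x≮a (<-trans x<y y<a))
... | no  x≮a | no  y≮a rewrite lift-≥ (≮⇒≥ x≮a) | lift-≥ (≮⇒≥ y≮a) = s≤s x<y

lift-≢ : ∀ a c → lift a c ≢ a
lift-≢ a c with c <? a
... | yes c<a rewrite lift-< c<a = <⇒≢ c<a
... | no  c≮a rewrite lift-≥ (≮⇒≥ c≮a) = >⇒≢ (s≤s (≮⇒≥ c≮a))

lift-injective : ∀ a {x y} → lift a x ≡ lift a y → x ≡ y
lift-injective a {x} {y} e with <-cmp x y
... | tri< x<y _ _ = ⊥-elim (<⇒≢ (lift-strictMono a x<y) e)
... | tri≈ _ x≡y _ = x≡y
... | tri> _ _ y<x = ⊥-elim (>⇒≢ (lift-strictMono a y<x) e)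

subseqs-map : (φ : ℕ → ℕ) → ∀ k σ → subseqs k (map φ σ) ≡ map (map φ) (subseqs k σ)
subseqs-map φ zero    σ       = refl
subseqs-map φ (suc k) []      = refl
subseqs-map φ (suc k) (x ∷ σ) = begin
  map (φ x ∷_) (subseqs k (map φ σ)) ++ subseqs (suc k) (map φ σ)
    ≡⟨ cong₂ _++_ (cong (map (φ x ∷_)) (subseqs-map φ k σ)) (subseqs-map φ (suc k) σ) ⟩
  map (φ x ∷_) (map (map φ) (subseqs k σ)) ++ map (map φ) (subseqs (suc k) σ)
    ≡⟨ cong (_++ map (map φ) (subseqs (suc k) σ)) (trans (sym (map-∘ (subseqs k σ))) (map-∘ (subseqs k σ))) ⟩
  map (map φ) (map (x ∷_) (subseqs k σ)) ++ map (map φ) (subseqs (suc k) σ)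
    ≡⟨ sym (map-++ (map φ) (map (x ∷_) (subseqs k σ)) (subseqs (suc k) σ)) ⟩
  map (map φ) (map (x ∷_) (subseqs k σ) ++ subseqs (suc k) σ) ∎

module _ (φ : ℕ → ℕ) (φ-strictMono : ∀ {x y} → x < y → φ x < φ y) where

  strictMono-<ᵇ : ∀ x y → (φ x <ᵇ φ y) ≡ (x <ᵇ y)
  strictMono-<ᵇ x y with <-cmp x y
  ... | tri< x<y _ _    = trans (<⇒<ᵇ≡true (φ-strictMono x<y)) (sym (<⇒<ᵇ≡true x<y))
  ... | tri≈ _ refl _   = trans (<ᵇ-irrefl (φ x)) (sym (<ᵇ-irrefl x))
  ... | tri> _ _ y<x    = trans (≥⇒<ᵇ≡false (<⇒≤ (φ-strictMono y<x))) (sym (≥⇒<ᵇ≡false (<⇒≤ y<x)))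

  strictMono-≡ᵇ : ∀ x y → (φ x ≡ᵇ φ y) ≡ (x ≡ᵇ y)
  strictMono-≡ᵇ x y with <-cmp x y
  ... | tri< x<y _ _    = trans (≢⇒≡ᵇ≡false (<⇒≢ (φ-strictMono x<y))) (sym (≢⇒≡ᵇ≡false (<⇒≢ x<y)))
  ... | tri≈ _ refl _   = trans (≡ᵇ-refl (φ x)) (sym (≡ᵇ-refl x))
  ... | tri> _ _ y<x    = trans (≢⇒≡ᵇ≡false (>⇒≢ (φ-strictMono y<x))) (sym (≢⇒≡ᵇ≡false (>⇒≢ y<x)))

  private
    φ₁ : ℕ × ℕ → ℕ × ℕ
    φ₁ (x , t) = (φ x , t)

    zip-map : ∀ s (τ : List ℕ) → zip (map φ s) τ ≡ map φ₁ (zip s τ)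
    zip-map []      τ       = refl
    zip-map (x ∷ s) []      = refl
    zip-map (x ∷ s) (t ∷ τ) = cong ((φ x , t) ∷_) (zip-map s τ)

    agreeAll-map : ∀ ps → agreeAll (map φ₁ ps) ≡ agreeAll ps
    agreeAll-map ps = trans (allᵇ-map φ₁ ps (λ p → allᵇ (agree p) (map φ₁ ps)))
      (allᵇ-cong ps (λ p → trans (allᵇ-map φ₁ ps (agree (φ₁ p)))
        (allᵇ-cong ps (λ q → cong (λ b → not (b xor (proj₂ p <ᵇ proj₂ q))) (strictMono-<ᵇ (proj₁ p) (proj₁ q))))))

  orderIso-map : ∀ τ s → orderIso τ (map φ s) ≡ orderIso τ s
  orderIso-map τ s = cong₂ _∧_ (cong (length τ ≡ᵇ_) (length-map φ s))
                               (trans (cong agreeAll (zip-map s τ)) (agreeAll-map (zip s τ)))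

  occ-map : ∀ τ σ → occ τ (map φ σ) ≡ occ τ σ
  occ-map τ σ = begin
    occ τ (map φ σ)
      ≡⟨ occ-as-∑ τ (map φ σ) ⟩
    ∑ (subseqs (length τ) (map φ σ)) [iso]
      ≡⟨ cong (λ L → ∑ L [iso]) (subseqs-map φ (length τ) σ) ⟩
    ∑ (map (map φ) (subseqs (length τ) σ)) [iso]
      ≡⟨ ∑-map (map φ) (subseqs (length τ) σ) [iso] ⟩
    ∑ (subseqs (length τ) σ) (λ s → ⟦ orderIso τ (map φ s) ⟧)
      ≡⟨ ∑-cong (subseqs (length τ) σ) (λ s → cong ⟦_⟧ (orderIso-map τ s)) ⟩
    ∑ (subseqs (length τ) σ) [iso]
      ≡⟨ sym (occ-as-∑ τ σ) ⟩
    occ τ σ ∎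
    where
    [iso] : List ℕ → ℕ
    [iso] s = ⟦ orderIso τ s ⟧

  increasingSubseqs-map : ∀ k σ → increasingSubseqs k (map φ σ) ≡ increasingSubseqs k σ
  increasingSubseqs-map k σ = begin
    increasingSubseqs k (map φ σ) ≡⟨ sym (occ-increasing suc s≤s k (map φ σ)) ⟩
    occ (idPat k) (map φ σ)       ≡⟨ occ-map (idPat k) σ ⟩
    occ (idPat k) σ               ≡⟨ occ-increasing suc s≤s k σ ⟩
    increasingSubseqs k σ         ∎

a<ᵇlift : ∀ a v → (a <ᵇ lift a v) ≡ (a ≤ᵇ v)
a<ᵇlift a v with v <? a
... | yes v<a rewrite lift-< v<a = trans (≥⇒<ᵇ≡false (<⇒≤ v<a)) (sym (>⇒≤ᵇ≡false v<a))
... | no  v≮a rewrite lift-≥ (≮⇒≥ v≮a) = <ᵇ-suc a v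

filterᵇ-lift : ∀ a σ → filterᵇ (a <ᵇ_) (map (lift a) σ) ≡ map (lift a) (filterᵇ (a ≤ᵇ_) σ)
filterᵇ-lift a σ = trans (filterᵇ-map (a <ᵇ_) (lift a) σ)
                         (cong (map (lift a)) (filterᵇ-congᴬ {L = σ} (All.tabulate (λ {v} _ → a<ᵇlift a v))))

InRange : ℕ → ℕ → Set
InRange n v = 1 ≤ v × v ≤ n

All-InRange-applyUpTo : ∀ n → All (InRange n) (applyUpTo suc n)
All-InRange-applyUpTo n = All.applyUpTo⁺₁ suc n (λ i<n → s≤s z≤n , i<n)

lift-InRange : ∀ a {n c} → InRange n c → InRange (suc n) (lift a c)
lift-InRange a {n} {c} (1≤c , c≤n) with c <? a
... | yes c<a rewrite lift-< c<a = 1≤c , m≤n⇒m≤1+n c≤n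
... | no  c≮a rewrite lift-≥ (≮⇒≥ c≮a) = s≤s z≤n , s≤s c≤n

∑-skip : ∀ N a → 1 ≤ a → a ≤ suc N → (F : ℕ → ℕ) →
         ∑ (applyUpTo suc (suc N)) (λ b → ⟦ not (a ≡ᵇ b) ⟧ * F b) ≡ ∑ (applyUpTo suc N) (F ∘ lift a)
∑-skip N a 1≤a a≤1+N F with m≤n⇒m<n∨m≡n a≤1+N
... | inj₂ refl = begin
  ∑ (applyUpTo suc (suc N)) (λ b → ⟦ not (suc N ≡ᵇ b) ⟧ * F b)
    ≡⟨ ∑-applyUpTo-last suc N _ ⟩
  ∑ (applyUpTo suc N) (λ b → ⟦ not (suc N ≡ᵇ b) ⟧ * F b) + ⟦ not (suc N ≡ᵇ suc N) ⟧ * F (suc N)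
    ≡⟨ cong₂ _+_ (∑-congᴬ (All.map (λ (_ , b≤N) → kept b≤N) (All-InRange-applyUpTo N)))
                 (cong (λ b → ⟦ not b ⟧ * F (suc N)) (≡ᵇ-refl (suc N))) ⟩
  ∑ (applyUpTo suc N) (F ∘ lift (suc N)) + 0
    ≡⟨ +-identityʳ _ ⟩
  ∑ (applyUpTo suc N) (F ∘ lift (suc N)) ∎
  where
  kept : ∀ {b} → b ≤ N → ⟦ not (suc N ≡ᵇ b) ⟧ * F b ≡ F (lift (suc N) b)
  kept {b} b≤N rewrite ≢⇒≡ᵇ≡false (>⇒≢ (s≤s b≤N)) | lift-< {suc N} (s≤s b≤N) = +-identityʳ (F b)
∑-skip (suc N) a 1≤a _ F | inj₁ (s≤s a≤1+N) = begin
  ∑ (applyUpTo suc (suc (suc N))) G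
    ≡⟨ ∑-applyUpTo-last suc (suc N) G ⟩
  ∑ (applyUpTo suc (suc N)) G + G (suc (suc N))
    ≡⟨ cong₂ _+_ (∑-skip N a 1≤a a≤1+N F) last ⟩
  ∑ (applyUpTo suc N) (F ∘ lift a) + F (lift a (suc N))
    ≡⟨ sym (∑-applyUpTo-last suc N (F ∘ lift a)) ⟩
  ∑ (applyUpTo suc (suc N)) (F ∘ lift a) ∎
  where
  G : ℕ → ℕ
  G b = ⟦ not (a ≡ᵇ b) ⟧ * F b
  last : G (suc (suc N)) ≡ F (lift a (suc N))
  last rewrite ≢⇒≡ᵇ≡false (<⇒≢ (s≤s a≤1+N)) | lift-≥ a≤1+N = +-identityʳ _
∑-skip zero (suc zero) _ _ F | inj₁ (s≤s ())

-- map (lift a) is a bijection from the words on {1..N} onto the words on {1..N+1} avoiding a.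
∑-words-notIn : ∀ N a → 1 ≤ a → a ≤ suc N → ∀ m (H : List ℕ → ℕ) →
                ∑ (words (suc N) m) (λ w → ⟦ notIn a w ⟧ * H w) ≡ ∑ (words N m) (H ∘ map (lift a))
∑-words-notIn N a 1≤a a≤1+N zero    H = cong (_+ 0) (+-identityʳ (H []))
∑-words-notIn N a 1≤a a≤1+N (suc m) H = begin
  ∑ (concatMap (λ b → map (b ∷_) tails) letters) (λ w → ⟦ notIn a w ⟧ * H w)
    ≡⟨ ∑-concatMap (λ b → map (b ∷_) tails) letters _ ⟩
  ∑ letters (λ b → ∑ (map (b ∷_) tails) (λ w → ⟦ notIn a w ⟧ * H w))
    ≡⟨ ∑-cong letters (λ b → trans (∑-map (b ∷_) tails _)
                                   (trans (∑-cong tails (split-head b)) (sym (*-∑ ⟦ not (a ≡ᵇ b) ⟧ tails _)))) ⟩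
  ∑ letters (λ b → ⟦ not (a ≡ᵇ b) ⟧ * ∑ tails (λ w → ⟦ notIn a w ⟧ * H (b ∷ w)))
    ≡⟨ ∑-cong letters (λ b → cong (⟦ not (a ≡ᵇ b) ⟧ *_) (∑-words-notIn N a 1≤a a≤1+N m (H ∘ (b ∷_)))) ⟩
  ∑ letters (λ b → ⟦ not (a ≡ᵇ b) ⟧ * ∑ (words N m) (λ σ → H (b ∷ map (lift a) σ)))
    ≡⟨ ∑-skip N a 1≤a a≤1+N (λ b → ∑ (words N m) (λ σ → H (b ∷ map (lift a) σ))) ⟩
  ∑ (applyUpTo suc N) (λ c → ∑ (words N m) (λ σ → H (lift a c ∷ map (lift a) σ)))
    ≡⟨ sym (∑-cong (applyUpTo suc N) (λ c → ∑-map (c ∷_) (words N m) (H ∘ map (lift a)))) ⟩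
  ∑ (applyUpTo suc N) (λ c → ∑ (map (c ∷_) (words N m)) (H ∘ map (lift a)))
    ≡⟨ sym (∑-concatMap (λ c → map (c ∷_) (words N m)) (applyUpTo suc N) _) ⟩
  ∑ (words N (suc m)) (H ∘ map (lift a)) ∎
  where
  tails : List (List ℕ)
  letters : List ℕ
  tails = words (suc N) m
  letters = applyUpTo suc (suc N)
  split-head : ∀ b w → ⟦ notIn a (b ∷ w) ⟧ * H (b ∷ w) ≡ ⟦ not (a ≡ᵇ b) ⟧ * (⟦ notIn a w ⟧ * H (b ∷ w))
  split-head b w = trans (cong (_* H (b ∷ w)) (⟦∧⟧ (not (a ≡ᵇ b)) (notIn a w)))
                         (*-assoc ⟦ not (a ≡ᵇ b) ⟧ ⟦ notIn a w ⟧ (H (b ∷ w)))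

distinct-lift : ∀ a σ → distinct (map (lift a) σ) ≡ distinct σ
distinct-lift a []      = refl
distinct-lift a (x ∷ σ) = cong₂ _∧_ (notIn-lift x σ) (distinct-lift a σ)
  where
  notIn-lift : ∀ x s → notIn (lift a x) (map (lift a) s) ≡ notIn x s
  notIn-lift x []      = refl
  notIn-lift x (y ∷ s) = cong₂ (λ p q → not p ∧ q) (strictMono-≡ᵇ (lift a) (lift-strictMono a) x y) (notIn-lift x s)

∑-perms-suc : ∀ n (G : List ℕ → ℕ) →
              ∑ (perms (suc n)) G ≡ ∑ (applyUpTo suc (suc n)) (λ a → ∑ (perms n) (λ σ → G (a ∷ map (lift a) σ)))
∑-perms-suc n G = begin
  ∑ (filterᵇ distinct (words (suc n) (suc n))) G
    ≡⟨ ∑-filterᵇ distinct (words (suc n) (suc n)) G ⟩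
  ∑ (concatMap (λ a → map (a ∷_) tails) letters) (λ π → ⟦ distinct π ⟧ * G π)
    ≡⟨ ∑-concatMap (λ a → map (a ∷_) tails) letters _ ⟩
  ∑ letters (λ a → ∑ (map (a ∷_) tails) (λ π → ⟦ distinct π ⟧ * G π))
    ≡⟨ ∑-congᴬ (All.map (λ (1≤a , a≤) → first-letter 1≤a a≤) (All-InRange-applyUpTo (suc n))) ⟩
  ∑ letters (λ a → ∑ (perms n) (λ σ → G (a ∷ map (lift a) σ))) ∎
  where
  tails : List (List ℕ)
  letters : List ℕ
  tails = words (suc n) n
  letters = applyUpTo suc (suc n)
  first-letter : ∀ {a} → 1 ≤ a → a ≤ suc n →
                 ∑ (map (a ∷_) tails) (λ π → ⟦ distinct π ⟧ * G π) ≡ ∑ (perms n) (λ σ → G (a ∷ map (lift a) σ))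
  first-letter {a} 1≤a a≤ = begin
    ∑ (map (a ∷_) tails) (λ π → ⟦ distinct π ⟧ * G π)
      ≡⟨ ∑-map (a ∷_) tails _ ⟩
    ∑ tails (λ w → ⟦ notIn a w ∧ distinct w ⟧ * G (a ∷ w))
      ≡⟨ ∑-cong tails (λ w → trans (cong (_* G (a ∷ w)) (⟦∧⟧ (notIn a w) (distinct w)))
                                   (*-assoc ⟦ notIn a w ⟧ ⟦ distinct w ⟧ (G (a ∷ w)))) ⟩
    ∑ tails (λ w → ⟦ notIn a w ⟧ * (⟦ distinct w ⟧ * G (a ∷ w)))
      ≡⟨ ∑-words-notIn n a 1≤a a≤ n (λ w → ⟦ distinct w ⟧ * G (a ∷ w)) ⟩
    ∑ (words n n) (λ σ → ⟦ distinct (map (lift a) σ) ⟧ * G (a ∷ map (lift a) σ))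
      ≡⟨ ∑-cong (words n n) (λ σ → cong (λ b → ⟦ b ⟧ * G (a ∷ map (lift a) σ)) (distinct-lift a σ)) ⟩
    ∑ (words n n) (λ σ → ⟦ distinct σ ⟧ * G (a ∷ map (lift a) σ))
      ≡⟨ sym (∑-filterᵇ distinct (words n n) _) ⟩
    ∑ (perms n) (λ σ → G (a ∷ map (lift a) σ)) ∎

permsᴰ : ℕ → List (List ℕ)
permsᴰ zero    = [ [] ]
permsᴰ (suc n) = concatMap (λ a → map (λ σ → a ∷ map (lift a) σ) (permsᴰ n)) (applyUpTo suc (suc n))

∑-permsᴰ-suc : ∀ n (G : List ℕ → ℕ) →
               ∑ (permsᴰ (suc n)) G ≡ ∑ (applyUpTo suc (suc n)) (λ a → ∑ (permsᴰ n) (λ σ → G (a ∷ map (lift a) σ)))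
∑-permsᴰ-suc n G = trans (∑-concatMap (λ a → map (λ σ → a ∷ map (lift a) σ) (permsᴰ n)) (applyUpTo suc (suc n)) G)
  (∑-cong (applyUpTo suc (suc n)) (λ a → ∑-map (λ σ → a ∷ map (lift a) σ) (permsᴰ n) G))

∑-perms≡∑-permsᴰ : ∀ n (G : List ℕ → ℕ) → ∑ (perms n) G ≡ ∑ (permsᴰ n) G
∑-perms≡∑-permsᴰ zero    G = refl
∑-perms≡∑-permsᴰ (suc n) G = begin
  ∑ (perms (suc n)) G
    ≡⟨ ∑-perms-suc n G ⟩
  ∑ (applyUpTo suc (suc n)) (λ a → ∑ (perms n) (λ σ → G (a ∷ map (lift a) σ)))
    ≡⟨ ∑-cong (applyUpTo suc (suc n)) (λ a → ∑-perms≡∑-permsᴰ n (λ σ → G (a ∷ map (lift a) σ))) ⟩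
  ∑ (applyUpTo suc (suc n)) (λ a → ∑ (permsᴰ n) (λ σ → G (a ∷ map (lift a) σ)))
    ≡⟨ sym (∑-permsᴰ-suc n G) ⟩
  ∑ (permsᴰ (suc n)) G ∎

record IsPerm (n : ℕ) (σ : List ℕ) : Set where
  field
    unique   : Unique σ
    inRange  : All (InRange n) σ
    complete : ∀ {v} → InRange n v → v ∈ σ

open IsPerm

IsPerm-∷-lift : ∀ {n a σ} → InRange (suc n) a → IsPerm n σ → IsPerm (suc n) (a ∷ map (lift a) σ)
IsPerm-∷-lift {n} {a} {σ} a-ok@(1≤a , a≤1+n) σ-perm = record
  { unique   = All.map⁺ (All.tabulate (λ {c} _ → lift-≢ a c ∘ sym)) ∷ Unique-map⁺ (lift-injective a) (unique σ-perm)
  ; inRange  = a-ok ∷ All.map⁺ (All.map (lift-InRange a) (inRange σ-perm))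
  ; complete = λ {v} v-ok → complete′ v v-ok
  }
  where
  complete′ : ∀ v → InRange (suc n) v → v ∈ a ∷ map (lift a) σ
  complete′ v (1≤v , v≤1+n) with <-cmp v a
  ... | tri≈ _ refl _ = here refl
  ... | tri< v<a _ _ =
    there (subst (_∈ map (lift a) σ) (lift-< v<a) (∈-map⁺ (lift a) (complete σ-perm (1≤v , ≤-pred (≤-trans v<a a≤1+n)))))
  complete′ (suc u) (_ , s≤s u≤n) | tri> _ _ (s≤s a≤u) =
    there (subst (_∈ map (lift a) σ) (lift-≥ a≤u) (∈-map⁺ (lift a) (complete σ-perm (≤-trans 1≤a a≤u , u≤n))))

∈-permsᴰ⁻ : ∀ n {σ} → σ ∈ permsᴰ n → IsPerm n σ
∈-permsᴰ⁻ zero    (here refl) = record { unique = [] ; inRange = [] ; complete = λ { (1≤v , v≤0) → ⊥-elim (<⇒≱ 1≤v v≤0) } }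
∈-permsᴰ⁻ (suc n) π∈
  with a , a∈ , π∈a ← ∈-concatMap⁻′ (applyUpTo suc (suc n)) π∈
  with σ , σ∈ , refl ← ∈-map⁻ _ π∈a
  = IsPerm-∷-lift (All.lookup (All-InRange-applyUpTo (suc n)) a∈) (∈-permsᴰ⁻ n σ∈)

IsPerm⇒↭ : ∀ {n σ} → IsPerm n σ → σ ↭ applyUpTo suc n
IsPerm⇒↭ {n} σ-perm = ∼bag⇒↭ (unique∧set⇒bag (unique σ-perm) (applyUpTo⁺₁ suc n (λ i<j _ → <⇒≢ i<j ∘ suc-injective))
                                 (mk⇔ (∈-range ∘ All.lookup (inRange σ-perm)) (complete σ-perm ∘ range-∈)))
  where
  ∈-range : ∀ {v} → InRange n v → v ∈ applyUpTo suc n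
  ∈-range {suc v} (_ , v<n) = ∈-applyUpTo⁺ suc v<n
  range-∈ : ∀ {v} → v ∈ applyUpTo suc n → InRange n v
  range-∈ v∈ with _ , i<n , refl ← ∈-applyUpTo⁻ suc v∈ = s≤s z≤n , i<n

count-≥-range : ∀ n a → 1 ≤ a → ∑ (applyUpTo suc n) (λ v → ⟦ a ≤ᵇ v ⟧) ≡ suc n ∸ a
count-≥-range zero    (suc a) _   = sym (0∸n≡0 a)
count-≥-range (suc n) a       1≤a =
  trans (∑-applyUpTo-last suc n _) (trans (cong (_+ ⟦ a ≤ᵇ suc n ⟧) (count-≥-range n a 1≤a)) (last (a ≤? suc n)))
  where
  last : Dec (a ≤ suc n) → suc n ∸ a + ⟦ a ≤ᵇ suc n ⟧ ≡ suc (suc n) ∸ a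
  last (yes a≤) rewrite ≤⇒≤ᵇ≡true a≤ = trans (+-comm (suc n ∸ a) 1) (sym (+-∸-assoc 1 a≤))
  last (no  a≰) rewrite >⇒≤ᵇ≡false (≰⇒> a≰) =
    trans (+-identityʳ _) (trans (m≤n⇒m∸n≡0 (<⇒≤ (≰⇒> a≰))) (sym (m≤n⇒m∸n≡0 (≰⇒> a≰))))

count-≥ : ∀ {n σ} → IsPerm n σ → ∀ a → 1 ≤ a → length (filterᵇ (a ≤ᵇ_) σ) ≡ suc n ∸ a
count-≥ {n} {σ} σ-perm a 1≤a =
  trans (length-filterᵇ (a ≤ᵇ_) σ) (trans (∑-↭ (λ v → ⟦ a ≤ᵇ v ⟧) (IsPerm⇒↭ σ-perm)) (count-≥-range n a 1≤a))

-- 132-avoiding permutations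

avoids132 : List ℕ → Bool
avoids132 = avoids pat132

first : List ℕ → ℕ
first []      = 1
first (x ∷ _) = x

avoids132-∷⇒ : ∀ x σ → avoids132 (x ∷ σ) ≡ true → inversions (filterᵇ (x <ᵇ_) σ) ≡ 0 × avoids132 σ ≡ true
avoids132-∷⇒ x σ e rewrite occ132-∷ x σ with inversions (filterᵇ (x <ᵇ_) σ) | occ pat132 σ
... | zero | zero = refl , refl

-- The letters above the first letter x of a 132-avoider increase, and if x > a then a comes after x.
increasing-≥ : ∀ {n σ} → IsPerm n σ → avoids132 σ ≡ true → ∀ a → InRange (suc n) a →
               increasingᵇ (filterᵇ (a ≤ᵇ_) σ) ≡ (first σ ≤ᵇ a)
increasing-≥ {σ = []}     _      _  a (1≤a , _) = sym (≤⇒≤ᵇ≡true 1≤a)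
increasing-≥ {n} {x ∷ σ} σ-perm av a (1≤a , a≤1+n) with avoids132-∷⇒ x σ av | x ≤? a
... | no-inv , _ | yes x≤a = trans (case (m≤n⇒m<n∨m≡n x≤a)) (sym (≤⇒≤ᵇ≡true x≤a))
  where
  x∉σ : All (x ≢_) σ
  x∉σ with x∉ ∷ _ ← unique σ-perm = x∉
  σ-unique : Unique σ
  σ-unique with _ ∷ u ← unique σ-perm = u
  above-x↑ : increasingᵇ (filterᵇ (x <ᵇ_) σ) ≡ true
  above-x↑ = trans (sym (inversions≡ᵇ0 _ (Unique-filter⁺ (T? ∘ (x <ᵇ_)) σ-unique))) (cong (_≡ᵇ 0) no-inv)
  case : x < a ⊎ x ≡ a → increasingᵇ (filterᵇ (a ≤ᵇ_) (x ∷ σ)) ≡ true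
  case (inj₁ x<a) rewrite >⇒≤ᵇ≡false x<a =
    trans (cong increasingᵇ (filterᵇ-filterᵇ (a ≤ᵇ_) (x <ᵇ_) σ
                               (λ v a≤v → <⇒<ᵇ≡true (<-≤-trans x<a (≤ᵇ≡true⇒≤ a v a≤v)))))
          (increasing-filterᵇ (a ≤ᵇ_) (filterᵇ (x <ᵇ_) σ) above-x↑)
  case (inj₂ refl) rewrite ≤⇒≤ᵇ≡true (≤-refl {x}) =
    trans (cong (λ L → allᵇ (x <ᵇ_) L ∧ increasingᵇ L) (filterᵇ-congᴬ (All.map ≢⇒≤ᵇ≡<ᵇ x∉σ)))
          (trans (cong (_∧ increasingᵇ (filterᵇ (x <ᵇ_) σ)) (allᵇ-filterᵇ (x <ᵇ_) σ)) above-x↑)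
... | _ | no x≰a rewrite ≤⇒≤ᵇ≡true (<⇒≤ (≰⇒> x≰a)) | >⇒≤ᵇ≡false (≰⇒> x≰a) =
  cong (_∧ increasingᵇ (filterᵇ (a ≤ᵇ_) σ)) (allᵇ-∈ (x <ᵇ_) a∈above-a (≥⇒<ᵇ≡false (<⇒≤ (≰⇒> x≰a))))
  where
  a∈σ : a ∈ σ
  a∈σ with complete σ-perm (1≤a , ≤-trans (<⇒≤ (≰⇒> x≰a)) (proj₂ (All.lookup (inRange σ-perm) (here refl))))
  ... | here a≡x  = ⊥-elim (<⇒≢ (≰⇒> x≰a) a≡x)
  ... | there a∈ = a∈
  a∈above-a : a ∈ filterᵇ (a ≤ᵇ_) σ
  a∈above-a = ∈-filter⁺ (T? ∘ (a ≤ᵇ_)) a∈σ (subst T (sym (≤⇒≤ᵇ≡true (≤-refl {a}))) _)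

occ132-∷-lift : ∀ a σ → occ pat132 (a ∷ map (lift a) σ) ≡ inversions (filterᵇ (a ≤ᵇ_) σ) + occ pat132 σ
occ132-∷-lift a σ = trans (occ132-∷ a (map (lift a) σ))
  (cong₂ _+_ (trans (cong inversions (filterᵇ-lift a σ)) (occ-map (lift a) (lift-strictMono a) (3 ∷ 2 ∷ []) (filterᵇ (a ≤ᵇ_) σ)))
             (occ-map (lift a) (lift-strictMono a) pat132 σ))

occIdPat-∷-lift : ∀ k a σ → occ (idPat (suc k)) (a ∷ map (lift a) σ) ≡
                  increasingSubseqs k (filterᵇ (a ≤ᵇ_) σ) + occ (idPat (suc k)) σ
occIdPat-∷-lift k a σ = trans (occ-idPat-∷ k a (map (lift a) σ))
  (cong₂ _+_ (trans (cong (increasingSubseqs k) (filterᵇ-lift a σ))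
                    (increasingSubseqs-map (lift a) (lift-strictMono a) k (filterᵇ (a ≤ᵇ_) σ)))
             (occ-map (lift a) (lift-strictMono a) (idPat (suc k)) σ))

avoids132-∷-lift : ∀ {n σ} → IsPerm n σ → ∀ a → InRange (suc n) a →
                   avoids132 (a ∷ map (lift a) σ) ≡ avoids132 σ ∧ (first σ ≤ᵇ a)
avoids132-∷-lift {n} {σ} σ-perm a a-ok = begin
  (occ pat132 (a ∷ map (lift a) σ) ≡ᵇ 0)          ≡⟨ cong (_≡ᵇ 0) (occ132-∷-lift a σ) ⟩
  (inversions above-a + occ pat132 σ ≡ᵇ 0)        ≡⟨ +-≡ᵇ-0 (inversions above-a) (occ pat132 σ) ⟩
  (inversions above-a ≡ᵇ 0) ∧ avoids132 σ
    ≡⟨ cong (_∧ avoids132 σ) (inversions≡ᵇ0 above-a (Unique-filter⁺ (T? ∘ (a ≤ᵇ_)) (unique σ-perm))) ⟩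
  increasingᵇ above-a ∧ avoids132 σ               ≡⟨ ∧-comm (increasingᵇ above-a) (avoids132 σ) ⟩
  avoids132 σ ∧ increasingᵇ above-a               ≡⟨ when-avoids (avoids132 σ) refl ⟩
  avoids132 σ ∧ (first σ ≤ᵇ a)                    ∎
  where
  above-a : List ℕ
  above-a = filterᵇ (a ≤ᵇ_) σ
  when-avoids : ∀ b → avoids132 σ ≡ b → b ∧ increasingᵇ above-a ≡ b ∧ (first σ ≤ᵇ a)
  when-avoids true  av = increasing-≥ σ-perm av a a-ok
  when-avoids false _  = refl

occIdPat-∷-lift-avoiding : ∀ k {n σ} → IsPerm n σ → avoids132 σ ≡ true →
                           ∀ a → InRange (suc n) a → (first σ ≤ᵇ a) ≡ true →
                           occ (idPat (suc k)) (a ∷ map (lift a) σ) ≡ (suc n ∸ a) C k + occ (idPat (suc k)) σ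
occIdPat-∷-lift-avoiding k {n} {σ} σ-perm av a a-ok@(1≤a , _) first≤a = trans (occIdPat-∷-lift k a σ)
  (cong (_+ occ (idPat (suc k)) σ)
        (trans (increasingSubseqs-increasing k (filterᵇ (a ≤ᵇ_) σ) (trans (increasing-≥ σ-perm av a a-ok) first≤a))
               (cong (_C k) (count-≥ σ-perm a 1≤a))))

statistics-∷-lift : ∀ k {n σ} (g : ℕ → ℕ) → IsPerm n σ → ∀ a → InRange (suc n) a →
                    ⟦ avoids132 (a ∷ map (lift a) σ) ⟧ * g (occ (idPat (suc k)) (a ∷ map (lift a) σ)) ≡
                    ⟦ avoids132 σ ⟧ * (⟦ first σ ≤ᵇ a ⟧ * g ((suc n ∸ a) C k + occ (idPat (suc k)) σ))
statistics-∷-lift k {σ = σ} g σ-perm a a-ok rewrite avoids132-∷-lift σ-perm a a-ok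
  with avoids132 σ in av | first σ ≤ᵇ a in first≤a
... | true  | true  rewrite occIdPat-∷-lift-avoiding k σ-perm av a a-ok first≤a = sym (+-identityʳ _)
... | true  | false = refl
... | false | _     = refl

first-InRange : ∀ {n σ} → IsPerm n σ → InRange (suc n) (first σ)
first-InRange {σ = []}    _      = s≤s z≤n , s≤s z≤n
first-InRange {σ = x ∷ σ} σ-perm with (1≤x , x≤n) ∷ _ ← inRange σ-perm = 1≤x , m≤n⇒m≤1+n x≤n

-- The bijection with level sequences

-- The substitution j = N + 1 − a.
∑-reflect : ∀ N l → 1 ≤ l → l ≤ suc N → (F : ℕ → ℕ) →
            ∑ (applyUpTo suc (suc N)) (λ a → ⟦ l ≤ᵇ a ⟧ * F (suc N ∸ a)) ≡ ∑ (upTo (suc (suc N ∸ l))) F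
∑-reflect N l 1≤l l≤1+N F with m≤n⇒m<n∨m≡n l≤1+N
... | inj₂ refl = begin
  ∑ (applyUpTo suc (suc N)) G
    ≡⟨ ∑-applyUpTo-last suc N G ⟩
  ∑ (applyUpTo suc N) G + G (suc N)
    ≡⟨ cong₂ _+_ (trans (∑-congᴬ (All.map (λ {a} (_ , a≤N) → cong (λ b → ⟦ b ⟧ * F (suc N ∸ a)) (>⇒≤ᵇ≡false (s≤s a≤N)))
                                          (All-InRange-applyUpTo N)))
                        (∑-zero (applyUpTo suc N) (λ _ → refl)))
                 (cong₂ (λ b x → ⟦ b ⟧ * F x) (≤⇒≤ᵇ≡true (≤-refl {suc N})) (n∸n≡0 N)) ⟩
  0 + (F 0 + 0)
    ≡⟨ cong (λ x → ∑ (upTo (suc x)) F) (sym (n∸n≡0 N)) ⟩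
  ∑ (upTo (suc (N ∸ N))) F ∎
  where
  G : ℕ → ℕ
  G a = ⟦ suc N ≤ᵇ a ⟧ * F (suc N ∸ a)
∑-reflect (suc N) l 1≤l _ F | inj₁ (s≤s l≤1+N) = begin
  ∑ (applyUpTo suc (suc (suc N))) G
    ≡⟨ ∑-applyUpTo-last suc (suc N) G ⟩
  ∑ (applyUpTo suc (suc N)) G + G (suc (suc N))
    ≡⟨ cong₂ _+_ (∑-congᴬ (All.map (λ {a} (_ , a≤) → cong (λ x → ⟦ l ≤ᵇ a ⟧ * F x) (+-∸-assoc 1 a≤))
                                   (All-InRange-applyUpTo (suc N))))
                 (cong₂ (λ b x → ⟦ b ⟧ * F x) (≤⇒≤ᵇ≡true (m≤n⇒m≤1+n l≤1+N)) (n∸n≡0 N)) ⟩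
  ∑ (applyUpTo suc (suc N)) (λ a → ⟦ l ≤ᵇ a ⟧ * F (suc (suc N ∸ a))) + (F 0 + 0)
    ≡⟨ cong₂ _+_ (∑-reflect N l 1≤l l≤1+N (F ∘ suc)) (+-identityʳ (F 0)) ⟩
  ∑ (upTo (suc (suc N ∸ l))) (F ∘ suc) + F 0
    ≡⟨ +-comm _ (F 0) ⟩
  F 0 + ∑ (upTo (suc (suc N ∸ l))) (F ∘ suc)
    ≡⟨ sym (∑-upTo-head (suc (suc N ∸ l)) F) ⟩
  ∑ (upTo (suc (suc (suc N ∸ l)))) F
    ≡⟨ cong (λ x → ∑ (upTo (suc x)) F) (sym (+-∸-assoc 1 l≤1+N)) ⟩
  ∑ (upTo (suc (suc (suc N) ∸ l))) F ∎
  where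
  G : ℕ → ℕ
  G a = ⟦ l ≤ᵇ a ⟧ * F (suc (suc N) ∸ a)
∑-reflect zero (suc zero) _ _ F | inj₁ (s≤s ())

-- Generalising over g is what lets the induction go through: the statistic n + 1 − first π
-- governs which letters may be prepended to π, just as cap s does for s.
∑-avoiders≡∑-levelSeqs : ∀ k n (g : ℕ → ℕ → ℕ) →
  ∑ (permsᴰ n) (λ π → ⟦ avoids132 π ⟧ * g (suc n ∸ first π) (occ (idPat (suc k)) π)) ≡
  ∑ (levelSeqs n) (λ s → g (cap s) (weight (suc k) 1 s))
∑-avoiders≡∑-levelSeqs k zero    g = cong (_+ 0) (+-identityʳ (g 0 0))
∑-avoiders≡∑-levelSeqs k (suc n) g = begin
  ∑ (permsᴰ (suc n)) Φ
    ≡⟨ ∑-permsᴰ-suc n Φ ⟩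
  ∑ letters (λ a → ∑ (permsᴰ n) (λ σ → Φ (a ∷ map (lift a) σ)))
    ≡⟨ ∑-congᴬ (All.map (λ {a} a-ok → ∑-congᴬ (All.tabulate (λ σ∈ →
                 statistics-∷-lift k (g (suc (suc n) ∸ a)) (∈-permsᴰ⁻ n σ∈) a a-ok)))
               (All-InRange-applyUpTo (suc n))) ⟩
  ∑ letters (λ a → ∑ (permsᴰ n) (λ σ → ⟦ avoids132 σ ⟧ * Ψ σ a))
    ≡⟨ ∑-comm letters (permsᴰ n) (λ a σ → ⟦ avoids132 σ ⟧ * Ψ σ a) ⟩
  ∑ (permsᴰ n) (λ σ → ∑ letters (λ a → ⟦ avoids132 σ ⟧ * Ψ σ a))
    ≡⟨ ∑-cong (permsᴰ n) (λ σ → sym (*-∑ ⟦ avoids132 σ ⟧ letters (Ψ σ))) ⟩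
  ∑ (permsᴰ n) (λ σ → ⟦ avoids132 σ ⟧ * ∑ letters (Ψ σ))
    ≡⟨ ∑-congᴬ (All.tabulate (λ {σ} σ∈ → cong (⟦ avoids132 σ ⟧ *_) (sum-over-first-letter (∈-permsᴰ⁻ n σ∈)))) ⟩
  ∑ (permsᴰ n) (λ σ → ⟦ avoids132 σ ⟧ * g′ (suc n ∸ first σ) (occ (idPat (suc k)) σ))
    ≡⟨ ∑-avoiders≡∑-levelSeqs k n g′ ⟩
  ∑ (levelSeqs n) (λ s → g′ (cap s) (weight (suc k) 1 s))
    ≡⟨ ∑-cong (levelSeqs n) (λ s → sym (sum-over-new-letter s)) ⟩
  ∑ (levelSeqs n) (λ s → ∑ (map (_∷ s) (upTo (suc (cap s)))) (λ s′ → g (cap s′) (weight (suc k) 1 s′)))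
    ≡⟨ sym (∑-concatMap (λ s → map (_∷ s) (upTo (suc (cap s)))) (levelSeqs n) _) ⟩
  ∑ (levelSeqs (suc n)) (λ s → g (cap s) (weight (suc k) 1 s)) ∎
  where
  letters : List ℕ
  letters = applyUpTo suc (suc n)
  Φ : List ℕ → ℕ
  Φ π = ⟦ avoids132 π ⟧ * g (suc (suc n) ∸ first π) (occ (idPat (suc k)) π)
  Ψ : List ℕ → ℕ → ℕ
  Ψ σ a = ⟦ first σ ≤ᵇ a ⟧ * g (suc (suc n) ∸ a) ((suc n ∸ a) C k + occ (idPat (suc k)) σ)
  g′ : ℕ → ℕ → ℕ
  g′ h o = ∑ (upTo (suc h)) (λ j → g (suc j) (j C k + o))

  sum-over-first-letter : ∀ {σ} → IsPerm n σ → ∑ letters (Ψ σ) ≡ g′ (suc n ∸ first σ) (occ (idPat (suc k)) σ)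
  sum-over-first-letter {σ} σ-perm = trans
    (∑-congᴬ (All.map (λ {a} (_ , a≤) → cong (λ x → ⟦ first σ ≤ᵇ a ⟧ * g x ((suc n ∸ a) C k + occ (idPat (suc k)) σ))
                                             (+-∸-assoc 1 a≤))
                      (All-InRange-applyUpTo (suc n))))
    (∑-reflect n (first σ) (proj₁ (first-InRange σ-perm)) (proj₂ (first-InRange σ-perm))
               (λ j → g (suc j) (j C k + occ (idPat (suc k)) σ)))

  sum-over-new-letter : ∀ s → ∑ (map (_∷ s) (upTo (suc (cap s)))) (λ s′ → g (cap s′) (weight (suc k) 1 s′)) ≡
                              g′ (cap s) (weight (suc k) 1 s)
  sum-over-new-letter s = trans (∑-map (_∷ s) (upTo (suc (cap s))) _)
    (∑-cong (upTo (suc (cap s))) (λ j → cong (λ x → g (suc j) (x C k + weight (suc k) 1 s)) (m+n∸n≡m j 1)))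

theorem2p1 : (k : ℕ) → 1 ≤ k → (n r m : ℕ) → n ≤ m → f k n r ≡ CF k m 1 n r
theorem2p1 (suc k) _ n r m n≤m = begin
  f (suc k) n r
    ≡⟨ length-filterᵇ _ (perms n) ⟩
  ∑ (perms n) (λ π → ⟦ avoids132 π ∧ (occ (idPat (suc k)) π ≡ᵇ r) ⟧)
    ≡⟨ ∑-cong (perms n) (λ π → ⟦∧⟧ (avoids132 π) _) ⟩
  ∑ (perms n) (λ π → ⟦ avoids132 π ⟧ * ⟦ occ (idPat (suc k)) π ≡ᵇ r ⟧)
    ≡⟨ ∑-perms≡∑-permsᴰ n _ ⟩
  ∑ (permsᴰ n) (λ π → ⟦ avoids132 π ⟧ * ⟦ occ (idPat (suc k)) π ≡ᵇ r ⟧)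
    ≡⟨ ∑-avoiders≡∑-levelSeqs k n (λ _ o → ⟦ o ≡ᵇ r ⟧) ⟩
  ∑ (levelSeqs n) (λ s → ⟦ weight (suc k) 1 s ≡ᵇ r ⟧)
    ≡⟨ sym (∑-↭ _ (cfᴱ↭levelSeqs m n n≤m)) ⟩
  gf (weight (suc k) 1) (cfᴱ m) n r
    ≡⟨ sym (CF≗gf-cfᴱ (suc k) m 1 n r) ⟩
  CF (suc k) m 1 n r ∎
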